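{- Let $n\ge1$ and let $\lambda$ be a partition with $|\lambda|\le n$. Then $$\psi_n(S_{\lambda,n})=\frac{1}{2^{\,n-|\lambda|}(n-|\lambda|)!}\binom{n-|\bar\lambda|}{m_1(\lambda)}K_{\bar\lambda}(n).$$
   Context: Partitions: $|\lambda|$ size, $m_i(\lambda)$ number of parts equal to $i$, $\lambda\cup\mu$ adds multiplicities, $(1^j)$ has $j$ parts equal to $1$; a partition is proper if it has no part $1$, and $\bar\lambda$ is $\lambda$ with all its parts equal to $1$ removed. For $n\ge1$ let $\rho(k)=\{2k-1,2k\}$ and let $\mathbf{P}_n$ be the set of subsets of $[2n]$ that are unions of sets $\rho(k)$, $1\le k\le n$. A partial bijection of $n$ is a triple $\alpha=(\sigma,d,d')$ with $d,d'\in\mathbf{P}_n$ and $\sigma:d\to d'$ a bijection; $Q_n$ is the set of these; a permutation $\omega$ of $[2n]$ is identified with $(\omega,[2n],[2n])$. Coset-type $ct(\alpha)$: take a graph with vertex set $d$, vertex $x$ having exterior label $x$ and interior label $\sigma(x)$; join by an exterior edge the vertices with exterior labels $2i-1,2i$ and by an interior edge the vertices with interior labels $2i-1,2i$; the graph is a disjoint union of cycles of lengths $2\mu_1\ge2\mu_2\ge\cdots$ and $ct(\alpha)=(\mu_1,\mu_2,\dots)$. $(\tilde\sigma,\tilde d,\tilde d')$ is a trivial extension of $(\sigma,d,d')$ if $d\subseteq\tilde d$, $\tilde\sigma|_d=\sigma$ and $ct(\tilde\sigma)=ct(\sigma)\cup(1^{|\tilde d\setminus d|/2})$; $P_\alpha(n)$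 is the set of trivial extensions in $Q_n$. $\psi_n:\mathbb{C}[Q_n]\to\mathbb{C}[\mathcal{S}_{2n}]$ is the linear map with $\psi_n((\sigma,d,d'))=\frac{1}{2^{n-|d|/2}(n-|d|/2)!}\sum_{\hat\alpha\in\mathcal{S}_{2n}\cap P_\alpha(n)}\hat\sigma$. $S_{\lambda,n}$ is the sum of all partial bijections of $n$ with coset-type $\lambda$. For a proper partition $\mu$ with $|\mu|\le n$, $K_\mu(n)$ is the sum of all permutations of $[2n]$ with coset-type $\mu\cup(1^{n-|\mu|})$. -}

module Defs where

open import Data.Nat as ℕ using (ℕ; zero; suc; _∸_; _^_; ⌊_/2⌋; _≤?_)
open import Data.Nat.Combinatorics using (_C_)
open import Data.Nat using (_!)
open import Data.Nat.Properties using (≤-decTotalOrder)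
open import Data.Bool using (Bool; true; false; _∧_; _∨_; not; if_then_else_)
open import Data.Fin as Fin using (Fin; zero; suc; combine; quotRem)
open import Data.Fin.Permutation using (Permutation′; _⟨$⟩ʳ_)
open import Data.Maybe using (Maybe; just; nothing; is-just)
open import Data.Maybe.Properties as MaybeP using ()
open import Data.Product using (_,_)
open import Data.List as List using (List; []; _∷_; _++_; replicate; filter; map; foldr; allFin; length)
open import Data.List.Properties as ListP using ()
open import Data.List.Relation.Unary.All using (All)
open import Data.List.Relation.Unary.Linked using (Linked)
open import Data.Vec as Vec using (Vec; lookup; tabulate)
open import Data.Integer using (+_)
open import Data.Rational as ℚ using (ℚ; 0ℚ; 1ℚ)
open import Relation.Nullary.Decidable using (⌊_⌋; ¬?)
import Data.Bool
open import Data.Nat.ListAction using (sum)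
open import Relation.Binary.PropositionalEquality using (_≡_)
open import Data.List.Sort.InsertionSort.Base ≤-decTotalOrder using (sort)

all : ∀ {A : Set} → (A → Bool) → List A → Bool
all p = foldr (λ x b → p x ∧ b) true

any : ∀ {A : Set} → (A → Bool) → List A → Bool
any p = foldr (λ x b → p x ∨ b) false

record Partition : Set where
  constructor mkPartition
  field
    parts      : List ℕ
    positive   : All (λ p → 1 ℕ.≤ p) parts
    decreasing : Linked ℕ._≥_ parts
open Partition public

size : Partition → ℕ
size λ′ = sum (parts λ′)

count : ℕ → List ℕ → ℕ
count i xs = length (filter (λ p → p ℕ.≟ i) xs)

mult : ℕ → Partition → ℕ
mult i λ′ = count i (parts λ′)

barParts : Partition → List ℕ
barParts λ′ = filter (λ p → ¬? (p ℕ.≟ 1)) (parts λ′)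

_≈ₘ_ : List ℕ → List ℕ → Bool
xs ≈ₘ ys = ⌊ ListP.≡-dec ℕ._≟_ (sort xs) (sort ys) ⌋

-- The ground set [2n], 0-indexed as Fin (n * 2): the element
-- combine i b = 2i + b (i : Fin n, b : Fin 2) is the label 2i+b+1 of the
-- paper, so ρ(i+1) = {combine i 0, combine i 1}.

Pt : ℕ → Set
Pt n = Fin (n ℕ.* 2)

flip2 : Fin 2 → Fin 2
flip2 zero = suc zero
flip2 (suc _) = zero

partner : ∀ {n} → Pt n → Pt n
partner {n} x with quotRem {n} 2 x
... | (b , i) = combine i (flip2 b)

_==_ : ∀ {m} → Fin m → Fin m → Bool
x == y = ⌊ x Fin.≟ y ⌋

_=?ₘ_ : ∀ {m} → Maybe (Fin m) → Maybe (Fin m) → Bool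
x =?ₘ y = ⌊ MaybeP.≡-dec Fin._≟_ x y ⌋

-- Partial maps of [2n].  A partial bijection (σ , d , d') is encoded by
-- the partial map p with  p x = just (σ x)  for x ∈ d and  p x = nothing
-- for x ∉ d; d is the domain of p and d' its image.

record PMap (n : ℕ) : Set where
  constructor pmap
  field
    table : Vec (Maybe (Pt n)) (n ℕ.* 2)
open PMap public

app : ∀ {n} → PMap n → Pt n → Maybe (Pt n)
app p x = lookup (table p) x

module _ {n : ℕ} (p : PMap n) where

  pts : List (Pt n)
  pts = allFin (n ℕ.* 2)

  inDom : Pt n → Bool
  inDom x = is-just (app p x)

  inIm : Pt n → Bool
  inIm y = any (λ x → app p x =?ₘ just y) pts

  domSize : ℕ
  domSize = length (filter (λ x → Data.Bool.T? (inDom x)) pts)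

  -- p is a partial bijection of n: d ∈ P_n, d' ∈ P_n (unions of blocks
  -- ρ(k), i.e. closed under partner) and σ : d → d' injective
  -- (surjectivity onto d' holds as d' is the image).
  isPartialBij : Bool
  isPartialBij =
    all (λ x → not (inDom x) ∨ inDom (partner {n} x)) pts
    ∧ all (λ y → not (inIm y) ∨ inIm (partner {n} y)) pts
    ∧ all (λ x → all (λ x′ → not (inDom x ∧ (app p x =?ₘ app p x′)) ∨ (x == x′)) pts) pts

  -- the coset-type graph: vertex set d; exterior edge between x and
  -- partner {n} x; interior edge between x and y when σ y = partner (σ x)
  extEdge : Pt n → Pt n → Bool
  extEdge x y = inDom x ∧ inDom y ∧ (y == partner {n} x)

  intEdge : Pt n → Pt n → Bool
  intEdge x y with app p x
  ... | nothing = false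
  ... | just z  = inDom y ∧ (app p y =?ₘ just (partner {n} z))

  adj : Pt n → Pt n → Bool
  adj x y = extEdge x y ∨ intEdge x y

  reach : ℕ → Pt n → Pt n → Bool
  reach zero    x y = x == y
  reach (suc k) x y = reach k x y ∨ any (λ z → reach k x z ∧ adj z y) pts

  component : Pt n → List (Pt n)
  component x = filter (λ y → Data.Bool.T? (reach (n ℕ.* 2) x y)) pts

  isLeast : Pt n → Bool
  isLeast x = all (λ y → not (reach (n ℕ.* 2) x y) ∨ ⌊ Fin.toℕ x ℕ.≤? Fin.toℕ y ⌋) pts

  -- ct(α): one part μ for every cycle of length 2μ (as a multiset,
  -- unsorted list)
  ct : List ℕ
  ct = map (λ x → ⌊ length (component x) /2⌋)
           (filter (λ x → Data.Bool.T? (inDom x ∧ isLeast x)) pts)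

allVecs : ∀ {A : Set} → List A → (k : ℕ) → List (Vec A k)
allVecs xs zero    = Vec.[] ∷ []
allVecs xs (suc k) = List.concatMap (λ x → map (x Vec.∷_) (allVecs xs k)) xs

allPMaps : (n : ℕ) → List (PMap n)
allPMaps n = map pmap (allVecs (nothing ∷ map just (allFin (n ℕ.* 2))) (n ℕ.* 2))

permToPMap : ∀ {n} → Permutation′ (n ℕ.* 2) → PMap n
permToPMap ω = pmap (tabulate (λ x → just (ω ⟨$⟩ʳ x)))

-- β is a trivial extension of α: σ̃ restricted to d is σ (hence d ⊆ d̃)
-- and ct(β) = ct(α) ∪ (1^{|d̃ ∖ d|/2})
isTrivialExt : ∀ {n} → PMap n → PMap n → Bool
isTrivialExt {n} α β =
  all (λ x → not (inDom α x) ∨ (app β x =?ₘ app α x)) (allFin (n ℕ.* 2))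
  ∧ (ct β ≈ₘ (ct α ++ replicate ⌊ domSize β ∸ domSize α /2⌋ 1))

-- Group algebras with rational coefficients, as coefficient functions.
-- ℚ[Q_n]: functions PMap n → ℚ (only values on partial bijections matter);
-- ℚ[S_{2n}]: functions Permutation′ (2n) → ℚ.

-- 1/k for k ≠ 0 (and 0 for k = 0, never used)
inv : ℕ → ℚ
inv zero    = 0ℚ
inv (suc k) = + 1 ℚ./ suc k

indicator : Bool → ℚ
indicator b = if b then 1ℚ else 0ℚ

ℚsum : List ℚ → ℚ
ℚsum = foldr ℚ._+_ 0ℚ

ψbasis : (n : ℕ) → PMap n → Permutation′ (n ℕ.* 2) → ℚ
ψbasis n α ω =
  inv (2 ^ (n ∸ ⌊ domSize α /2⌋) ℕ.* (n ∸ ⌊ domSize α /2⌋) !)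
  ℚ.* indicator (isTrivialExt α (permToPMap {n} ω))

ψ : (n : ℕ) → (PMap n → ℚ) → Permutation′ (n ℕ.* 2) → ℚ
ψ n f ω = ℚsum (map (λ α → f α ℚ.* ψbasis n α ω)
                     (filter (λ α → Data.Bool.T? (isPartialBij α)) (allPMaps n)))

S : Partition → (n : ℕ) → PMap n → ℚ
S λ′ n α = indicator (isPartialBij α ∧ (ct α ≈ₘ parts λ′))

K : List ℕ → (n : ℕ) → Permutation′ (n ℕ.* 2) → ℚ
K μ n ω = indicator (ct (permToPMap {n} ω) ≈ₘ (μ ++ replicate (n ∸ sum μ) 1))

-- If ω trivially extends a partial bijection α, then α is the restriction of ω to a union of
-- cycles of the coset-type graph of ω, and ct α lists the halved lengths of these cycles;
-- conversely every such restriction is a partial bijection trivially extended by ω.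
-- Hence α has coset-type λ exactly when the chosen cycles are all the nontrivial cycles of ω
-- (those of length > 2, which forces ct ω = λ̄ ∪ (1^{n-|λ̄|})) together with m₁(λ) of its
-- n - |λ̄| trivial cycles. There are (n - |λ̄|) C m₁(λ) such α, each contributing
-- 1/(2^{n-|λ|}(n-|λ|)!) to the coefficient of ω in ψ_n(S_{λ,n}).

module Submission where

open import Defs
open import Data.Nat as ℕ using (ℕ; zero; suc; _+_; _*_; _∸_; _≤_; _<_; z≤n; s≤s; _^_; _!; ⌊_/2⌋; _≡ᵇ_)
import Data.Nat.Properties as ℕP
open import Data.Nat.Combinatorics using (_C_; nCk+nC[k+1]≡[n+1]C[k+1])
open import Data.Nat.ListAction using (sum)
open import Data.Nat.ListAction.Properties using (sum-↭; sum-++)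
open import Data.Bool using (Bool; true; false; _∧_; _∨_; not; if_then_else_; T)
open import Data.Fin as Fin using (Fin; zero; suc; toℕ)
import Data.Fin.Properties as FinP
open import Data.Fin.Subset using (Subset; ∣_∣)
open import Data.Fin.Subset.Properties using (_⊆?_)
open import Data.Fin.Permutation using (Permutation′; _⟨$⟩ʳ_; _⟨$⟩ˡ_; inverseˡ; inverseʳ)
open import Data.List as List using (List; []; _∷_; _++_; map; filter; length; replicate; allFin; concatMap)
import Data.List.Properties as ListP
open import Data.List.Membership.Propositional using (_∈_)
open import Data.List.Membership.Propositional.Properties
  using (∈-allFin; ∈-map⁺; ∈-map⁻; ∈-++⁺ˡ; ∈-++⁺ʳ; ∈-++⁻; ∈-∃++; ∈-filter⁺; ∈-filter⁻)
open import Data.List.Relation.Unary.Any using (here; there)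
open import Data.List.Relation.Unary.All using (All; []; _∷_)
import Data.List.Relation.Unary.All as All
open import Data.List.Relation.Unary.AllPairs using ([]; _∷_)
open import Data.List.Relation.Unary.Unique.Propositional using (Unique)
import Data.List.Relation.Unary.Unique.Propositional.Properties as Unique
open import Data.Maybe using (Maybe; just; nothing; is-just)
import Data.Maybe.Properties as MaybeP
open import Data.Vec as Vec using (Vec; []; _∷_; lookup; tabulate)
import Data.Vec.Properties as VecP
open import Data.Product using (∃; _×_; _,_; proj₂)
open import Data.Sum using (_⊎_; inj₁; inj₂)
open import Data.Empty using (⊥-elim)
open import Function using (_∘_; Equivalence)
open import Relation.Binary.PropositionalEquality
open import Relation.Nullary using (Dec; yes; no; ¬_; does)
open import Relation.Nullary.Decidable using (⌊_⌋; ¬?; T?; dec-true)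
open import Data.List.Relation.Binary.Permutation.Propositional
  using (_↭_; ↭-refl; ↭-sym; ↭-trans; ↭⇒↭ₛ; prep; module PermutationReasoning)
open import Data.List.Relation.Binary.Permutation.Propositional.Properties
  using (drop-∷; ++⁺ʳ; shift; ∈-resp-↭; filter-↭; ↭-length) renaming (map⁺ to ↭-map⁺)
open import Data.List.Relation.Binary.Pointwise using (Pointwise-≡⇒≡)
open import Data.List.Sort.InsertionSort.Base ℕP.≤-decTotalOrder using (sort)
open import Data.List.Sort.InsertionSort.Properties ℕP.≤-decTotalOrder using (sort-↭; sort-↗)
import Data.List.Relation.Unary.Sorted.TotalOrder.Properties as Sorted
open import Data.Bool.Properties using (∧-assoc; ∧-zeroʳ; ∨-conicalʳ; not-injective; not-¬; ¬-not; T-≡)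
open import Data.Integer as ℤ using ()
import Data.Integer.Properties as ℤP
open import Data.Rational as ℚ using (ℚ; mkℚ; 0ℚ; 1ℚ)
import Data.Rational.Properties as ℚP
import Data.Nat.Coprimality as Coprime
open import Algebra.Properties.Semiring.Sum ℕP.+-*-semiring using (sum-syntax; ∑-comm; sum-cong-≗; sum-replicate-zero; *-distribʳ-sum)

∧-elimˡ : ∀ {a b} → a ∧ b ≡ true → a ≡ true
∧-elimˡ {true} _ = refl

∧-elimʳ : ∀ {a b} → a ∧ b ≡ true → b ≡ true
∧-elimʳ {true} e = e

∧-intro : ∀ {a b} → a ≡ true → b ≡ true → a ∧ b ≡ true
∧-intro refl refl = refl

∨-elim : ∀ {a b} → a ∨ b ≡ true → a ≡ true ⊎ b ≡ true
∨-elim {true} _ = inj₁ refl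
∨-elim {false} e = inj₂ e

∨-introˡ : ∀ {a} b → a ≡ true → a ∨ b ≡ true
∨-introˡ b refl = refl

∨-introʳ : ∀ a {b} → b ≡ true → a ∨ b ≡ true
∨-introʳ true _ = refl
∨-introʳ false e = e

⇒ᵇ-elim : ∀ {a b} → not a ∨ b ≡ true → a ≡ true → b ≡ true
⇒ᵇ-elim {true} e refl = e

⇒ᵇ-intro : ∀ {a b} → (a ≡ true → b ≡ true) → not a ∨ b ≡ true
⇒ᵇ-intro {true} h = h refl
⇒ᵇ-intro {false} h = refl

true-or-false : ∀ b → b ≡ true ⊎ b ≡ false
true-or-false true = inj₁ refl
true-or-false false = inj₂ refl

≡true-ext : ∀ {a b} → (a ≡ true → b ≡ true) → (b ≡ true → a ≡ true) → a ≡ b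
≡true-ext {true} {true} f g = refl
≡true-ext {true} {false} f g = sym (f refl)
≡true-ext {false} {true} f g = g refl
≡true-ext {false} {false} f g = refl

≡true⇒T : ∀ {b} → b ≡ true → T b
≡true⇒T = Equivalence.from T-≡

T⇒≡true : ∀ {b} → T b → b ≡ true
T⇒≡true = Equivalence.to T-≡

⌊⌋-sound : ∀ {P : Set} (d : Dec P) → ⌊ d ⌋ ≡ true → P
⌊⌋-sound (yes p) _ = p

⌊⌋-complete : ∀ {P : Set} (d : Dec P) → P → ⌊ d ⌋ ≡ true
⌊⌋-complete (yes p) _ = refl
⌊⌋-complete (no ¬p) p = ⊥-elim (¬p p)

≡ᵇ-sound : ∀ {a b} → (a ≡ᵇ b) ≡ true → a ≡ b
≡ᵇ-sound {a} {b} e = ℕP.≡ᵇ⇒≡ a b (≡true⇒T e)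

≡ᵇ-complete : ∀ {a b} → a ≡ b → (a ≡ᵇ b) ≡ true
≡ᵇ-complete {a} {b} e = T⇒≡true (ℕP.≡⇒≡ᵇ a b e)

module _ {A : Set} (p : A → Bool) where

  any-intro : ∀ {xs x} → x ∈ xs → p x ≡ true → any p xs ≡ true
  any-intro {y ∷ _} (here refl) e = ∨-introˡ _ e
  any-intro {y ∷ _} (there m) e = ∨-introʳ (p y) (any-intro m e)

  any-elim : ∀ xs → any p xs ≡ true → ∃ λ x → x ∈ xs × p x ≡ true
  any-elim (y ∷ xs) e with ∨-elim {p y} e
  ... | inj₁ e₁ = y , here refl , e₁
  ... | inj₂ e₂ = let (x , m , q) = any-elim xs e₂ in x , there m , q

  all-intro : ∀ xs → (∀ x → x ∈ xs → p x ≡ true) → all p xs ≡ true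
  all-intro [] h = refl
  all-intro (y ∷ xs) h = ∧-intro (h y (here refl)) (all-intro xs (λ x m → h x (there m)))

  all-elim : ∀ {xs x} → all p xs ≡ true → x ∈ xs → p x ≡ true
  all-elim {y ∷ _} e (here refl) = ∧-elimˡ e
  all-elim {y ∷ _} e (there m) = all-elim (∧-elimʳ {p y} e) m

  all-false : ∀ xs → all p xs ≡ false → ∃ λ x → p x ≡ false
  all-false (y ∷ xs) e with p y in eq
  ... | true = all-false xs e
  ... | false = y , eq

module _ {m : ℕ} (p : Fin m → Bool) where

  anyFin-intro : ∀ x → p x ≡ true → any p (allFin m) ≡ true
  anyFin-intro x = any-intro p (∈-allFin x)

  anyFin-elim : any p (allFin m) ≡ true → ∃ λ x → p x ≡ true
  anyFin-elim e = let (x , _ , q) = any-elim p (allFin m) e in x , q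

  allFin-intro : (∀ x → p x ≡ true) → all p (allFin m) ≡ true
  allFin-intro h = all-intro p (allFin m) (λ x _ → h x)

  allFin-elim : all p (allFin m) ≡ true → ∀ x → p x ≡ true
  allFin-elim e x = all-elim p e (∈-allFin x)

module _ {A : Set} {p q : A → Bool} (p≗q : ∀ x → p x ≡ q x) where

  any-cong : ∀ xs → any p xs ≡ any q xs
  any-cong [] = refl
  any-cong (x ∷ xs) = cong₂ _∨_ (p≗q x) (any-cong xs)

  all-cong : ∀ xs → all p xs ≡ all q xs
  all-cong [] = refl
  all-cong (x ∷ xs) = cong₂ _∧_ (p≗q x) (all-cong xs)

  filter-cong : ∀ xs → filter (T? ∘ p) xs ≡ filter (T? ∘ q) xs
  filter-cong [] = refl
  filter-cong (x ∷ xs) with p x | q x | p≗q x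
  ... | true | true | _ = cong (x ∷_) (filter-cong xs)
  ... | false | false | _ = filter-cong xs

map-cong-filter : ∀ {A B : Set} {g h : A → B} (p : A → Bool) xs →
  (∀ x → p x ≡ true → g x ≡ h x) → map g (filter (T? ∘ p) xs) ≡ map h (filter (T? ∘ p) xs)
map-cong-filter p [] e = refl
map-cong-filter p (x ∷ xs) e with p x in eq
... | true = cong₂ _∷_ (e x eq) (map-cong-filter p xs e)
... | false = map-cong-filter p xs e

[_]ᵇ : Bool → ℕ
[ true ]ᵇ = 1
[ false ]ᵇ = 0

countFin : (m : ℕ) → (Fin m → Bool) → ℕ
countFin m p = ∑[ i < m ] [ p i ]ᵇ

⌊n*2/2⌋≡n : ∀ n → ⌊ n * 2 /2⌋ ≡ n
⌊n*2/2⌋≡n zero = refl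
⌊n*2/2⌋≡n (suc n) = cong suc (⌊n*2/2⌋≡n n)

⌊[m*2∸n*2]/2⌋≡m∸n : ∀ m n → ⌊ m * 2 ∸ n * 2 /2⌋ ≡ m ∸ n
⌊[m*2∸n*2]/2⌋≡m∸n m n = trans (cong ⌊_/2⌋ (sym (ℕP.*-distribʳ-∸ 2 m n))) (⌊n*2/2⌋≡n (m ∸ n))

∑-zero : ∀ m (g : Fin m → ℕ) → (∀ i → g i ≡ 0) → ∑[ i < m ] g i ≡ 0
∑-zero m g g≗0 = trans (sum-cong-≗ g≗0) (sum-replicate-zero m)

countFin-cong : ∀ m {p q : Fin m → Bool} → (∀ i → p i ≡ q i) → countFin m p ≡ countFin m q
countFin-cong m p≗q = sum-cong-≗ (cong [_]ᵇ ∘ p≗q)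

countFin-true : ∀ m → countFin m (λ _ → true) ≡ m
countFin-true zero = refl
countFin-true (suc m) = cong suc (countFin-true m)

countFin-false : ∀ m (p : Fin m → Bool) → (∀ i → p i ≡ false) → countFin m p ≡ 0
countFin-false m p p≗false = ∑-zero m _ (cong [_]ᵇ ∘ p≗false)

countFin-≤ : ∀ m (p : Fin m → Bool) → countFin m p ≤ m
countFin-≤ zero p = z≤n
countFin-≤ (suc m) p with p zero
... | true = s≤s (countFin-≤ m (p ∘ suc))
... | false = ℕP.m≤n⇒m≤1+n (countFin-≤ m (p ∘ suc))

countFin-mono : ∀ m (p q : Fin m → Bool) → (∀ i → p i ≡ true → q i ≡ true) → countFin m p ≤ countFin m q
countFin-mono zero p q p⊆q = z≤n
countFin-mono (suc m) p q p⊆q with p zero in e | q zero in e′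
... | true | true = s≤s (countFin-mono m _ _ (p⊆q ∘ suc))
... | true | false = ⊥-elim (not-¬ (p⊆q zero e) e′)
... | false | true = ℕP.m≤n⇒m≤1+n (countFin-mono m _ _ (p⊆q ∘ suc))
... | false | false = countFin-mono m _ _ (p⊆q ∘ suc)

countFin-strict : ∀ m (p q : Fin m → Bool) → (∀ i → p i ≡ true → q i ≡ true) →
  ∀ j → q j ≡ true → p j ≡ false → countFin m p < countFin m q
countFin-strict (suc m) p q p⊆q zero qj pj rewrite qj | pj = s≤s (countFin-mono m _ _ (p⊆q ∘ suc))
countFin-strict (suc m) p q p⊆q (suc j) qj pj with p zero in e | q zero in e′
... | true | true = s≤s (countFin-strict m _ _ (p⊆q ∘ suc) j qj pj)
... | true | false = ⊥-elim (not-¬ (p⊆q zero e) e′)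
... | false | true = ℕP.m≤n⇒m≤1+n (countFin-strict m _ _ (p⊆q ∘ suc) j qj pj)
... | false | false = countFin-strict m _ _ (p⊆q ∘ suc) j qj pj

countFin-pos : ∀ m (p : Fin m → Bool) j → p j ≡ true → 0 < countFin m p
countFin-pos m p j pj = subst (_< countFin m p) (countFin-false m _ (λ _ → refl))
  (countFin-strict m (λ _ → false) p (λ _ ()) j pj refl)

countFin-unique : ∀ m (p : Fin m → Bool) r → p r ≡ true → (∀ i → p i ≡ true → i ≡ r) → countFin m p ≡ 1
countFin-unique (suc m) p zero pr uniq rewrite pr =
  cong suc (countFin-false m _ (λ i → ¬-not (λ e → FinP.0≢1+n (sym (uniq (suc i) e)))))
countFin-unique (suc m) p (suc r) pr uniq with p zero in e₀
... | true = ⊥-elim (FinP.0≢1+n (uniq zero e₀))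
... | false = countFin-unique m (p ∘ suc) r pr (λ i e → FinP.suc-injective (uniq (suc i) e))

least-satisfying : ∀ {m} (P : Fin m → Bool) z → P z ≡ true →
  ∃ λ r → P r ≡ true × (∀ z′ → P z′ ≡ true → toℕ r ≤ toℕ z′)
least-satisfying {suc m} P z Pz with P zero in e₀
... | true = zero , e₀ , (λ _ _ → z≤n)
least-satisfying {suc m} P zero Pz | false = ⊥-elim (not-¬ Pz e₀)
least-satisfying {suc m} P (suc z) Pz | false =
  let (r , Pr , minimal) = least-satisfying (P ∘ suc) z Pz in suc r , Pr , minimal-suc r minimal
  where
  minimal-suc : ∀ r → (∀ z′ → P (suc z′) ≡ true → toℕ r ≤ toℕ z′) →
                ∀ z′ → P z′ ≡ true → toℕ (suc r) ≤ toℕ z′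
  minimal-suc r minimal zero Pz′ = ⊥-elim (not-¬ Pz′ e₀)
  minimal-suc r minimal (suc z′) Pz′ = s≤s (minimal z′ Pz′)

module _ {A : Set} (p : A → Bool) where

  length-filter-tabulate : ∀ m (g : Fin m → A) →
    length (filter (T? ∘ p) (List.tabulate g)) ≡ countFin m (p ∘ g)
  length-filter-tabulate zero g = refl
  length-filter-tabulate (suc m) g with p (g zero)
  ... | true = cong suc (length-filter-tabulate m (g ∘ suc))
  ... | false = length-filter-tabulate m (g ∘ suc)

  sum-map-filter-tabulate : ∀ (h : A → ℕ) m (g : Fin m → A) →
    sum (map h (filter (T? ∘ p) (List.tabulate g))) ≡ ∑[ i < m ] (if p (g i) then h (g i) else 0)
  sum-map-filter-tabulate h zero g = refl
  sum-map-filter-tabulate h (suc m) g with p (g zero)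
  ... | true = cong (h (g zero) +_) (sum-map-filter-tabulate h m (g ∘ suc))
  ... | false = sum-map-filter-tabulate h m (g ∘ suc)

countList : ∀ {A : Set} → (A → Bool) → List A → ℕ
countList p [] = 0
countList p (x ∷ xs) = [ p x ]ᵇ + countList p xs

module _ {A : Set} (p : A → Bool) where

  countList-++ : ∀ xs ys → countList p (xs ++ ys) ≡ countList p xs + countList p ys
  countList-++ [] ys = refl
  countList-++ (x ∷ xs) ys = trans (cong ([ p x ]ᵇ +_) (countList-++ xs ys)) (sym (ℕP.+-assoc [ p x ]ᵇ _ _))

  countList-map : ∀ {B : Set} (g : B → A) xs → countList p (map g xs) ≡ countList (p ∘ g) xs
  countList-map g [] = refl
  countList-map g (x ∷ xs) = cong ([ p (g x) ]ᵇ +_) (countList-map g xs)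

  countList-false : ∀ xs → (∀ x → p x ≡ false) → countList p xs ≡ 0
  countList-false [] _ = refl
  countList-false (x ∷ xs) p≗false rewrite p≗false x = countList-false xs p≗false

  countList-filter : ∀ (q : A → Bool) xs → countList p (filter (T? ∘ q) xs) ≡ countList (λ x → q x ∧ p x) xs
  countList-filter q [] = refl
  countList-filter q (x ∷ xs) with q x
  ... | true = cong ([ p x ]ᵇ +_) (countList-filter q xs)
  ... | false = countList-filter q xs

length-filter≡countList : ∀ {A : Set} {P : A → Set} (P? : (x : A) → Dec (P x)) xs →
  length (filter P? xs) ≡ countList (does ∘ P?) xs
length-filter≡countList P? [] = refl
length-filter≡countList P? (x ∷ xs) with does (P? x)
... | true = cong suc (length-filter≡countList P? xs)
... | false = length-filter≡countList P? xs

==-sound : ∀ {m} {x y : Fin m} → (x == y) ≡ true → x ≡ y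
==-sound {x = x} {y} = ⌊⌋-sound (x Fin.≟ y)

==-complete : ∀ {m} {x y : Fin m} → x ≡ y → (x == y) ≡ true
==-complete {x = x} {y} = ⌊⌋-complete (x Fin.≟ y)

=?ₘ-sound : ∀ {m} {x y : Maybe (Fin m)} → (x =?ₘ y) ≡ true → x ≡ y
=?ₘ-sound {x = x} {y} = ⌊⌋-sound (MaybeP.≡-dec Fin._≟_ x y)

=?ₘ-complete : ∀ {m} {x y : Maybe (Fin m)} → x ≡ y → (x =?ₘ y) ≡ true
=?ₘ-complete {x = x} {y} = ⌊⌋-complete (MaybeP.≡-dec Fin._≟_ x y)

partner-involutive : ∀ {n} (x : Pt n) → partner {n} (partner {n} x) ≡ x
partner-involutive {suc n} zero = refl
partner-involutive {suc n} (suc zero) = refl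
partner-involutive {suc n} (suc (suc x)) = cong (λ z → suc (suc z)) (partner-involutive {n} x)

countFin-partner-even : ∀ n (P : Pt n → Bool) → (∀ x → P (partner {n} x) ≡ P x) →
  ∃ λ h → countFin (n * 2) P ≡ h * 2
countFin-partner-even zero P _ = 0 , refl
countFin-partner-even (suc n) P P-partner =
  let (h , eh) = countFin-partner-even n (λ x → P (suc (suc x))) (λ x → P-partner (suc (suc x)))
  in [ P zero ]ᵇ + h , (begin
    [ P zero ]ᵇ + ([ P (suc zero) ]ᵇ + countFin (n * 2) (λ x → P (suc (suc x))))
      ≡⟨ cong₂ (λ b c → [ P zero ]ᵇ + ([ b ]ᵇ + c)) (P-partner zero) eh ⟩
    [ P zero ]ᵇ + ([ P zero ]ᵇ + h * 2)
      ≡⟨ double (P zero) h ⟩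
    ([ P zero ]ᵇ + h) * 2 ∎)
  where
  open ≡-Reasoning
  double : ∀ b h → [ b ]ᵇ + ([ b ]ᵇ + h * 2) ≡ ([ b ]ᵇ + h) * 2
  double true h = refl
  double false h = refl

-- Connectivity in the coset-type graph

module CosetGraph {n : ℕ} (p : PMap n) where

  N : ℕ
  N = n * 2

  intEdge-elim : ∀ z y → intEdge p z y ≡ true →
    ∃ λ w → app p z ≡ just w × app p y ≡ just (partner {n} w)
  intEdge-elim z y e with app p z
  ... | just w = w , refl , =?ₘ-sound (∧-elimʳ {inDom p y} e)

  intEdge-intro : ∀ z y w → app p z ≡ just w → app p y ≡ just (partner {n} w) → intEdge p z y ≡ true
  intEdge-intro z y w pz py with app p z | pz
  ... | just .w | refl rewrite py = =?ₘ-complete refl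

  extEdge-elim : ∀ z y → extEdge p z y ≡ true → inDom p z ≡ true × inDom p y ≡ true × y ≡ partner {n} z
  extEdge-elim z y e = ∧-elimˡ e , ∧-elimˡ (∧-elimʳ {inDom p z} e) , ==-sound (∧-elimʳ {inDom p y} (∧-elimʳ {inDom p z} e))

  extEdge-intro : ∀ z y → inDom p z ≡ true → inDom p y ≡ true → y ≡ partner {n} z → extEdge p z y ≡ true
  extEdge-intro z y dz dy y≡z′ = ∧-intro dz (∧-intro dy (==-complete y≡z′))

  adj-sym : ∀ z y → adj p z y ≡ true → adj p y z ≡ true
  adj-sym z y e with ∨-elim {extEdge p z y} e
  ... | inj₁ ext = let (dz , dy , y≡z′) = extEdge-elim z y ext in
    ∨-introˡ _ (extEdge-intro y z dy dz (trans (sym (partner-involutive {n} z)) (cong (partner {n}) (sym y≡z′))))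
  ... | inj₂ int = let (w , pz , py) = intEdge-elim z y int in
    ∨-introʳ (extEdge p y z) (intEdge-intro y z (partner {n} w) py (trans pz (cong just (sym (partner-involutive {n} w)))))

  reach-step : ∀ k x z y → reach p k x z ≡ true → adj p z y ≡ true → reach p (suc k) x y ≡ true
  reach-step k x z y xz zy = ∨-introʳ (reach p k x y) (anyFin-intro (λ z → reach p k x z ∧ adj p z y) z (∧-intro xz zy))

  reach-≤ : ∀ {j k} x y → j ≤ k → reach p j x y ≡ true → reach p k x y ≡ true
  reach-≤ {j} {k} x y j≤k e with k ∸ j | ℕP.m+[n∸m]≡n j≤k
  ... | d | refl = go d
    where
    go : ∀ d → reach p (j + d) x y ≡ true
    go zero = subst (λ t → reach p t x y ≡ true) (sym (ℕP.+-identityʳ j)) e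
    go (suc d) = subst (λ t → reach p t x y ≡ true) (sym (ℕP.+-suc j d)) (∨-introˡ _ (go d))

  reach-ind : ∀ (P : Pt n → Set) x → P x → (∀ z y → P z → adj p z y ≡ true → P y) →
    ∀ k y → reach p k x y ≡ true → P y
  reach-ind P x Px closed zero y e = subst P (==-sound e) Px
  reach-ind P x Px closed (suc k) y e with ∨-elim {reach p k x y} e
  ... | inj₁ e₁ = reach-ind P x Px closed k y e₁
  ... | inj₂ e₂ = let (z , q) = anyFin-elim (λ z → reach p k x z ∧ adj p z y) e₂ in
    closed z y (reach-ind P x Px closed k z (∧-elimˡ q)) (∧-elimʳ {reach p k x z} q)

  reach-trans : ∀ a b x y z → reach p a x y ≡ true → reach p b y z ≡ true → reach p (b + a) x z ≡ true
  reach-trans a zero x y z xy yz = subst (λ t → reach p a x t ≡ true) (==-sound yz) xy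
  reach-trans a (suc b) x y z xy yz with ∨-elim {reach p b y z} yz
  ... | inj₁ e = ∨-introˡ _ (reach-trans a b x y z xy e)
  ... | inj₂ e = let (w , q) = anyFin-elim (λ w → reach p b y w ∧ adj p w z) e in
    reach-step (b + a) x w z (reach-trans a b x y w xy (∧-elimˡ q)) (∧-elimʳ {reach p b y w} q)

  module _ (x : Pt n) where

    Stable : ℕ → Set
    Stable k = ∀ y → reach p (suc k) x y ≡ true → reach p k x y ≡ true

    stable-forever : ∀ k → Stable k → ∀ j y → reach p (j + k) x y ≡ true → reach p k x y ≡ true
    stable-forever k stable zero y e = e
    stable-forever k stable (suc j) y e with ∨-elim {reach p (j + k) x y} e
    ... | inj₁ e₁ = stable-forever k stable j y e₁
    ... | inj₂ e₂ = let (z , q) = anyFin-elim (λ z → reach p (j + k) x z ∧ adj p z y) e₂ in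
      stable y (reach-step k x z y (stable-forever k stable j z (∧-elimˡ q)) (∧-elimʳ {reach p (j + k) x z} q))

    Saturated : ℕ → Set
    Saturated k = ∀ m y → reach p m x y ≡ true → reach p k x y ≡ true

    grows-or-saturated : ∀ k → k < countFin N (reach p k x) ⊎ Saturated k
    grows-or-saturated zero = inj₁ (countFin-pos N _ x (==-complete refl))
    grows-or-saturated (suc k) with grows-or-saturated k
    ... | inj₂ sat = inj₂ (λ m y e → ∨-introˡ _ (sat m y e))
    ... | inj₁ grows with all (λ y → not (reach p (suc k) x y) ∨ reach p k x y) (allFin N) in eq
    ...   | true = inj₂ (λ m y e → ∨-introˡ _ (saturated m y e))
      where
      stable : Stable k
      stable y = ⇒ᵇ-elim (allFin-elim (λ y → not (reach p (suc k) x y) ∨ reach p k x y) eq y)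
      saturated : Saturated k
      saturated m y e with ℕP.≤-total m k
      ... | inj₁ m≤k = reach-≤ x y m≤k e
      ... | inj₂ k≤m = stable-forever k stable (m ∸ k) y (subst (λ t → reach p t x y ≡ true) (sym (ℕP.m∸n+n≡m k≤m)) e)
    ...   | false =
      let (y , q) = all-false (λ y → not (reach p (suc k) x y) ∨ reach p k x y) (allFin N) eq
      in inj₁ (ℕP.<-≤-trans (s≤s grows)
           (countFin-strict N _ _ (λ i → ∨-introˡ _) y (new-reached q) (new-unreached q)))
      where
      new-reached : ∀ {a b} → not a ∨ b ≡ false → a ≡ true
      new-reached {true} _ = refl
      new-unreached : ∀ {a b} → not a ∨ b ≡ false → b ≡ false
      new-unreached {true} e = e

    -- A ball that kept growing would have more than N points at radius N.
    saturated-at-N : Saturated N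
    saturated-at-N with grows-or-saturated N
    ... | inj₁ N<count = ⊥-elim (ℕP.<⇒≱ N<count (countFin-≤ N _))
    ... | inj₂ sat = sat

  Connected : Pt n → Pt n → Bool
  Connected = reach p N

  connected-refl : ∀ x → Connected x x ≡ true
  connected-refl x = reach-≤ {k = N} x x z≤n (==-complete refl)

  connected-step : ∀ x z y → Connected x z ≡ true → adj p z y ≡ true → Connected x y ≡ true
  connected-step x z y xz zy = saturated-at-N x (suc N) y (reach-step N x z y xz zy)

  connected-trans : ∀ x y z → Connected x y ≡ true → Connected y z ≡ true → Connected x z ≡ true
  connected-trans x y z xy yz = saturated-at-N x (N + N) z (reach-trans N N x y z xy yz)

  connected-sym : ∀ x y → Connected x y ≡ true → Connected y x ≡ true
  connected-sym x y = reach-ind (λ t → Connected t x ≡ true) x (connected-refl x)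
    (λ z t tx zt → connected-trans t z x (connected-step t t z (connected-refl t) (adj-sym z t zt)) tx) N y

  connected-ind : ∀ (P : Pt n → Set) x → P x → (∀ z y → P z → adj p z y ≡ true → P y) →
    ∀ y → Connected x y ≡ true → P y
  connected-ind P x Px closed y = reach-ind P x Px closed N y

  isLeast-minimal : ∀ x y → isLeast p x ≡ true → Connected x y ≡ true → toℕ x ≤ toℕ y
  isLeast-minimal x y least xy = ⌊⌋-sound (toℕ x ℕ.≤? toℕ y)
    (⇒ᵇ-elim (allFin-elim (λ y → not (Connected x y) ∨ ⌊ toℕ x ℕ.≤? toℕ y ⌋) least y) xy)

  isLeast-unique : ∀ r r′ → isLeast p r ≡ true → isLeast p r′ ≡ true → Connected r r′ ≡ true → r ≡ r′
  isLeast-unique r r′ lr lr′ rr′ = FinP.toℕ-injective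
    (ℕP.≤-antisym (isLeast-minimal r r′ lr rr′) (isLeast-minimal r′ r lr′ (connected-sym r r′ rr′)))

  representative : ∀ y → ∃ λ r → isLeast p r ≡ true × Connected r y ≡ true
  representative y =
    let (r , yr , minimal) = least-satisfying (Connected y) y (connected-refl y) in
    r , allFin-intro _ (λ z → ⇒ᵇ-intro (λ rz → ⌊⌋-complete (toℕ r ℕ.≤? toℕ z) (minimal z (connected-trans y r z yr rz)))) ,
    connected-sym y r yr

-- Restrictions of a permutation to unions of its cycles

module Restriction {n : ℕ} (ω : Permutation′ (n * 2)) where

  N : ℕ
  N = n * 2

  σ : Pt n → Pt n
  σ x = ω ⟨$⟩ʳ x

  σ-injective : ∀ {x y} → σ x ≡ σ y → x ≡ y
  σ-injective {x} {y} e = trans (sym (inverseˡ ω)) (trans (cong (ω ⟨$⟩ˡ_) e) (inverseˡ ω))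

  W : PMap n
  W = permToPMap {n} ω

  open CosetGraph W public
    using (Connected; connected-refl; connected-sym; connected-trans; connected-step; connected-ind;
           isLeast-unique; representative)
  open CosetGraph W using (extEdge-elim; extEdge-intro; intEdge-elim; intEdge-intro; reach-ind)

  restrict : (Pt n → Bool) → PMap n
  restrict D = pmap (tabulate (λ y → if D y then just (σ y) else nothing))

  app-restrict : ∀ D y → app (restrict D) y ≡ (if D y then just (σ y) else nothing)
  app-restrict D y = VecP.lookup∘tabulate (λ y → if D y then just (σ y) else nothing) y

  inDom-restrict : ∀ D y → inDom (restrict D) y ≡ D y
  inDom-restrict D y rewrite app-restrict D y with D y
  ... | true = refl
  ... | false = refl

  restrict-cong : ∀ {D D′} → (∀ y → D y ≡ D′ y) → restrict D ≡ restrict D′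
  restrict-cong D≗D′ = cong pmap (VecP.tabulate-cong (λ y → cong (λ b → if b then just (σ y) else nothing) (D≗D′ y)))

  app-restrict-inside : ∀ D y → D y ≡ true → app (restrict D) y ≡ just (σ y)
  app-restrict-inside D y e rewrite app-restrict D y | e = refl

  app-restrict-just : ∀ D y v → app (restrict D) y ≡ just v → D y ≡ true × σ y ≡ v
  app-restrict-just D y v e rewrite app-restrict D y with D y
  ... | true = refl , MaybeP.just-injective e

  app-W : ∀ y → app W y ≡ just (σ y)
  app-W = app-restrict (λ _ → true)

  inDom-W : ∀ y → inDom W y ≡ true
  inDom-W = inDom-restrict (λ _ → true)

  adj-partner : ∀ z → adj W z (partner {n} z) ≡ true
  adj-partner z = ∨-introˡ _ (extEdge-intro z (partner {n} z) (inDom-W z) (inDom-W (partner {n} z)) refl)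

  Closed : (Pt n → Bool) → Set
  Closed D = ∀ z y → D z ≡ true → adj W z y ≡ true → D y ≡ true

  everything-closed : Closed (λ _ → true)
  everything-closed _ _ _ _ = refl

  module _ (D : Pt n → Bool) (closed : Closed D) where

    private
      module GD = CosetGraph (restrict D)

    adj-restrict : ∀ z y → D z ≡ true → adj (restrict D) z y ≡ adj W z y
    adj-restrict z y dz = ≡true-ext to from
      where
      to : adj (restrict D) z y ≡ true → adj W z y ≡ true
      to e with ∨-elim {extEdge (restrict D) z y} e
      ... | inj₁ ext = let (_ , _ , y≡z′) = GD.extEdge-elim z y ext in
        ∨-introˡ _ (extEdge-intro z y (inDom-W z) (inDom-W y) y≡z′)
      ... | inj₂ int = let (w , pz , py) = GD.intEdge-elim z y int
                           (_ , σz) = app-restrict-just D z w pz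
                           (_ , σy) = app-restrict-just D y _ py in
        ∨-introʳ (extEdge W z y) (intEdge-intro z y w (trans (app-W z) (cong just σz)) (trans (app-W y) (cong just σy)))
      from : adj W z y ≡ true → adj (restrict D) z y ≡ true
      from e with ∨-elim {extEdge W z y} e
      ... | inj₁ ext = let (_ , _ , y≡z′) = extEdge-elim z y ext in
        ∨-introˡ _ (GD.extEdge-intro z y (trans (inDom-restrict D z) dz) (trans (inDom-restrict D y) (closed z y dz e)) y≡z′)
      ... | inj₂ int = let (w , pz , py) = intEdge-elim z y int
                           σz = MaybeP.just-injective (trans (sym (app-W z)) pz)
                           σy = MaybeP.just-injective (trans (sym (app-W y)) py) in
        ∨-introʳ (extEdge (restrict D) z y) (GD.intEdge-intro z y w (trans (app-restrict-inside D z dz) (cong just σz))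
          (trans (app-restrict-inside D y (closed z y dz e)) (cong just σy)))

    reach-restrict : ∀ x → D x ≡ true → ∀ k y → reach (restrict D) k x y ≡ reach W k x y
    reach-restrict x dx zero y = refl
    reach-restrict x dx (suc k) y = cong₂ _∨_ (reach-restrict x dx k y) (any-cong step (allFin N))
      where
      step : ∀ z → (reach (restrict D) k x z ∧ adj (restrict D) z y) ≡ (reach W k x z ∧ adj W z y)
      step z rewrite reach-restrict x dx k z with reach W k x z in xz
      ... | true = adj-restrict z y (reach-ind (λ t → D t ≡ true) x dx closed k z xz)
      ... | false = refl

    component-restrict : ∀ x → D x ≡ true → component (restrict D) x ≡ component W x
    component-restrict x dx = filter-cong (reach-restrict x dx N) (allFin N)

    isLeast-restrict : ∀ x → D x ≡ true → isLeast (restrict D) x ≡ isLeast W x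
    isLeast-restrict x dx = all-cong (λ y → cong (λ t → not t ∨ ⌊ toℕ x ℕ.≤? toℕ y ⌋) (reach-restrict x dx N y)) (allFin N)

  -- ct ω records a cycle of length 2μ as μ = cycleSize r, r being its least vertex.
  cycleSize : Pt n → ℕ
  cycleSize r = ⌊ length (component W r) /2⌋

  leastIn : (Pt n → Bool) → List (Pt n)
  leastIn D = filter (λ x → T? (D x ∧ isLeast W x)) (allFin N)

  ct-restrict : ∀ D → Closed D → ct (restrict D) ≡ map cycleSize (leastIn D)
  ct-restrict D closed = trans
    (cong (map (λ x → ⌊ length (component (restrict D) x) /2⌋)) (filter-cong same-least (allFin N)))
    (map-cong-filter (λ x → D x ∧ isLeast W x) (allFin N)
      (λ x e → cong (λ t → ⌊ length t /2⌋) (component-restrict D closed x (∧-elimˡ e))))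
    where
    same-least : ∀ x → (inDom (restrict D) x ∧ isLeast (restrict D) x) ≡ (D x ∧ isLeast W x)
    same-least x rewrite inDom-restrict D x with D x in dx
    ... | true = isLeast-restrict D closed x dx
    ... | false = refl

  restrict-isPartialBij : ∀ D → Closed D → isPartialBij (restrict D) ≡ true
  restrict-isPartialBij D closed = ∧-intro dom-blocks (∧-intro image-blocks injective)
    where
    α = restrict D
    dom-blocks : all (λ x → not (inDom α x) ∨ inDom α (partner {n} x)) (allFin N) ≡ true
    dom-blocks = allFin-intro _ (λ x → ⇒ᵇ-intro (λ dx → trans (inDom-restrict D (partner {n} x))
      (closed x (partner {n} x) (trans (sym (inDom-restrict D x)) dx) (adj-partner x))))
    -- σ x = y and σ x′ = partner y make x and x′ adjacent through an interior edge.
    image-blocks : all (λ y → not (inIm α y) ∨ inIm α (partner {n} y)) (allFin N) ≡ true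
    image-blocks = allFin-intro _ (λ y → ⇒ᵇ-intro (λ im →
      let (x , q) = anyFin-elim (λ x → app α x =?ₘ just y) im
          (dx , σx) = app-restrict-just D x y (=?ₘ-sound q)
          x′ = ω ⟨$⟩ˡ partner {n} y
          σx′ : σ x′ ≡ partner {n} y
          σx′ = inverseʳ ω
          xx′ : adj W x x′ ≡ true
          xx′ = ∨-introʳ (extEdge W x x′)
            (intEdge-intro x x′ y (trans (app-W x) (cong just σx)) (trans (app-W x′) (cong just σx′)))
      in anyFin-intro (λ x → app α x =?ₘ just (partner {n} y)) x′
           (=?ₘ-complete (trans (app-restrict-inside D x′ (closed x x′ dx xx′)) (cong just σx′)))))
    injective : all (λ x → all (λ x′ → not (inDom α x ∧ (app α x =?ₘ app α x′)) ∨ (x == x′)) (allFin N)) (allFin N) ≡ true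
    injective = allFin-intro _ (λ x → allFin-intro _ (λ x′ → ⇒ᵇ-intro (λ e →
      let dx = trans (sym (inDom-restrict D x)) (∧-elimˡ e)
          same = =?ₘ-sound (∧-elimʳ {inDom α x} e)
          (_ , σx′) = app-restrict-just D x′ (σ x) (trans (sym same) (app-restrict-inside D x dx))
      in ==-complete (σ-injective (sym σx′)))))

  Agrees : PMap n → Set
  Agrees α = ∀ x → inDom α x ≡ true → app α x ≡ just (σ x)

  agrees-sound : ∀ α → all (λ x → not (inDom α x) ∨ (app W x =?ₘ app α x)) (allFin N) ≡ true → Agrees α
  agrees-sound α e x dx =
    trans (sym (=?ₘ-sound (⇒ᵇ-elim (allFin-elim (λ x → not (inDom α x) ∨ (app W x =?ₘ app α x)) e x) dx))) (app-W x)

  restrict-agrees : ∀ D → all (λ x → not (inDom (restrict D) x) ∨ (app W x =?ₘ app (restrict D) x)) (allFin N) ≡ true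
  restrict-agrees D = allFin-intro _ (λ x → ⇒ᵇ-intro (λ dx → =?ₘ-complete (trans (app-W x)
    (sym (app-restrict-inside D x (trans (sym (inDom-restrict D x)) dx))))))

  agrees⇒restrict : ∀ α → Agrees α → α ≡ restrict (inDom α)
  agrees⇒restrict (pmap t) agrees = cong pmap (trans (sym (VecP.tabulate∘lookup t)) (VecP.tabulate-cong entry))
    where
    entry : ∀ y → lookup t y ≡ (if inDom (pmap {n} t) y then just (σ y) else nothing)
    entry y with lookup t y in eq
    ... | nothing = refl
    ... | just v = trans (sym eq) (agrees y (subst (λ m → is-just m ≡ true) (sym eq) refl))

  -- The domain of a partial bijection agreeing with σ is closed under both kinds of edges:
  -- exterior edges since it is a union of blocks, interior ones since its image is.
  agrees⇒closed : ∀ α → isPartialBij α ≡ true → Agrees α → Closed (inDom α)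
  agrees⇒closed α pb agrees z y dz e with ∨-elim {extEdge W z y} e
  ... | inj₁ ext = let (_ , _ , y≡z′) = extEdge-elim z y ext in
    subst (λ t → inDom α t ≡ true) (sym y≡z′) (⇒ᵇ-elim (allFin-elim _ (∧-elimˡ pb) z) dz)
  ... | inj₂ int =
    let (w , pz , py) = intEdge-elim z y int
        σz = MaybeP.just-injective (trans (sym (app-W z)) pz)
        σy = MaybeP.just-injective (trans (sym (app-W y)) py)
        im-σz : inIm α (σ z) ≡ true
        im-σz = anyFin-intro (λ x → app α x =?ₘ just (σ z)) z (=?ₘ-complete (agrees z dz))
        im-blocks = ∧-elimˡ (∧-elimʳ {all (λ x → not (inDom α x) ∨ inDom α (partner {n} x)) (allFin N)} pb)
        (x′ , q) = anyFin-elim (λ x → app α x =?ₘ just (partner {n} (σ z)))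
                     (⇒ᵇ-elim (allFin-elim _ im-blocks (σ z)) im-σz)
        αx′ = =?ₘ-sound q
        dx′ : inDom α x′ ≡ true
        dx′ = subst (λ m → is-just m ≡ true) (sym αx′) refl
        σx′ = MaybeP.just-injective (trans (sym (agrees x′ dx′)) αx′)
    in subst (λ t → inDom α t ≡ true) (σ-injective (trans σx′ (trans (cong (partner {n}) σz) (sym σy)))) dx′

  length-component : ∀ r → length (component W r) ≡ countFin N (Connected r)
  length-component r = length-filter-tabulate (Connected r) N (λ i → i)

  cycle-length-even : ∀ r → length (component W r) ≡ cycleSize r * 2
  cycle-length-even r =
    let (h , eh) = countFin-partner-even n (Connected r) connected-partner
        len≡h*2 = trans (length-component r) eh
    in trans len≡h*2 (cong (_* 2) (sym (trans (cong ⌊_/2⌋ len≡h*2) (⌊n*2/2⌋≡n h))))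
    where
    connected-partner : ∀ y → Connected r (partner {n} y) ≡ Connected r y
    connected-partner y = ≡true-ext
      (λ e → subst (λ t → Connected r t ≡ true) (partner-involutive {n} y)
               (connected-step r (partner {n} y) _ e (adj-partner (partner {n} y))))
      (λ e → connected-step r y (partner {n} y) e (adj-partner y))

  -- Every vertex of a closed D lies on exactly one cycle, and the least vertex of that cycle is in D.
  countFin-closed : ∀ D → Closed D →
    countFin N D ≡ (∑[ r < N ] (if D r ∧ isLeast W r then cycleSize r else 0)) * 2
  countFin-closed D closed = begin
    ∑[ y < N ] [ D y ]ᵇ                                  ≡⟨ sum-cong-≗ one-cycle ⟩
    ∑[ y < N ] ∑[ r < N ] [ (D r ∧ isLeast W r) ∧ Connected r y ]ᵇ
      ≡⟨ ∑-comm (λ y r → [ (D r ∧ isLeast W r) ∧ Connected r y ]ᵇ) ⟩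
    ∑[ r < N ] ∑[ y < N ] [ (D r ∧ isLeast W r) ∧ Connected r y ]ᵇ
      ≡⟨ sum-cong-≗ (λ r → cycle r (D r ∧ isLeast W r)) ⟩
    ∑[ r < N ] ((if D r ∧ isLeast W r then cycleSize r else 0) * 2)
      ≡⟨ sym (*-distribʳ-sum 2 (λ r → if D r ∧ isLeast W r then cycleSize r else 0)) ⟩
    (∑[ r < N ] (if D r ∧ isLeast W r then cycleSize r else 0)) * 2 ∎
    where
    open ≡-Reasoning
    one-cycle : ∀ y → [ D y ]ᵇ ≡ countFin N (λ r → (D r ∧ isLeast W r) ∧ Connected r y)
    one-cycle y with D y in dy
    ... | true =
      let (r₀ , least₀ , r₀y) = representative y
          dr₀ = connected-ind (λ t → D t ≡ true) y dy closed r₀ (connected-sym r₀ y r₀y)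
      in sym (countFin-unique N _ r₀ (∧-intro (∧-intro dr₀ least₀) r₀y)
           (λ r e → isLeast-unique r r₀ (∧-elimʳ {D r} (∧-elimˡ e)) least₀
              (connected-trans r y r₀ (∧-elimʳ {D r ∧ isLeast W r} e) (connected-sym r₀ y r₀y))))
    ... | false = sym (countFin-false N _ (λ r → ¬-not (λ e → not-¬
      (connected-ind (λ t → D t ≡ true) r (∧-elimˡ (∧-elimˡ e)) closed y (∧-elimʳ {D r ∧ isLeast W r} e)) dy)))
    cycle : ∀ r b → countFin N (λ y → b ∧ Connected r y) ≡ (if b then cycleSize r else 0) * 2
    cycle r true = trans (sym (length-component r)) (cycle-length-even r)
    cycle r false = countFin-false N _ (λ _ → refl)

  domSize-restrict : ∀ D → domSize (restrict D) ≡ countFin N D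
  domSize-restrict D = trans (length-filter-tabulate (inDom (restrict D)) N (λ i → i))
    (countFin-cong N (inDom-restrict D))

  domSize-restrict≡sum-ct*2 : ∀ D → Closed D → domSize (restrict D) ≡ sum (ct (restrict D)) * 2
  domSize-restrict≡sum-ct*2 D closed = begin
    domSize (restrict D)                                              ≡⟨ domSize-restrict D ⟩
    countFin N D                                                      ≡⟨ countFin-closed D closed ⟩
    (∑[ r < N ] (if D r ∧ isLeast W r then cycleSize r else 0)) * 2   ≡⟨ cong (_* 2) sum-leastIn ⟩
    sum (ct (restrict D)) * 2 ∎
    where
    open ≡-Reasoning
    sum-leastIn = sym (trans (cong sum (ct-restrict D closed))
      (sum-map-filter-tabulate (λ x → D x ∧ isLeast W x) cycleSize N (λ i → i)))

  ct-W : ct W ≡ map cycleSize (leastIn (λ _ → true))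
  ct-W = ct-restrict (λ _ → true) everything-closed

  domSize-W : domSize W ≡ N
  domSize-W = trans (domSize-restrict (λ _ → true)) (countFin-true N)

  sum-ct-W : sum (ct W) ≡ n
  sum-ct-W = ℕP.*-cancelʳ-≡ (sum (ct W)) n 2
    (trans (sym (domSize-restrict≡sum-ct*2 (λ _ → true) everything-closed)) domSize-W)

≈ₘ⇒↭ : ∀ xs ys → (xs ≈ₘ ys) ≡ true → xs ↭ ys
≈ₘ⇒↭ xs ys e = ↭-trans (↭-sym (sort-↭ xs)) (subst (_↭ ys) (sym sorted-equal) (sort-↭ ys))
  where
  sorted-equal : sort xs ≡ sort ys
  sorted-equal = ⌊⌋-sound (ListP.≡-dec ℕ._≟_ (sort xs) (sort ys)) e

↭⇒≈ₘ : ∀ xs ys → xs ↭ ys → (xs ≈ₘ ys) ≡ true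
↭⇒≈ₘ xs ys xs↭ys = ⌊⌋-complete (ListP.≡-dec ℕ._≟_ (sort xs) (sort ys))
  (Pointwise-≡⇒≡ (Sorted.↗↭↗⇒≋ ℕP.≤-totalOrder (sort-↗ xs) (sort-↗ ys)
    (↭⇒↭ₛ (↭-trans (sort-↭ xs) (↭-trans xs↭ys (↭-sym (sort-↭ ys)))))))

↭-++-cancelˡ : ∀ {A : Set} (xs : List A) {ys zs} → xs ++ ys ↭ xs ++ zs → ys ↭ zs
↭-++-cancelˡ [] p = p
↭-++-cancelˡ (x ∷ xs) p = ↭-++-cancelˡ xs (drop-∷ p)

filter-↭-split : ∀ {A : Set} (p q : A → Bool) xs →
  filter (T? ∘ q) xs ↭ filter (λ x → T? (p x ∧ q x)) xs ++ filter (λ x → T? (not (p x) ∧ q x)) xs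
filter-↭-split p q [] = ↭-refl
filter-↭-split p q (x ∷ xs) with p x | q x
... | true | true = prep x (filter-↭-split p q xs)
... | true | false = filter-↭-split p q xs
... | false | true = ↭-trans (prep x (filter-↭-split p q xs))
  (↭-sym (shift x (filter (λ x → T? (p x ∧ q x)) xs) (filter (λ x → T? (not (p x) ∧ q x)) xs)))
... | false | false = filter-↭-split p q xs

isOne? : (p : ℕ) → Dec (p ≡ 1)
isOne? p = p ℕ.≟ 1

notOne? : (p : ℕ) → Dec (¬ p ≡ 1)
notOne? p = ¬? (p ℕ.≟ 1)

ones-↭ : ∀ xs → xs ↭ filter notOne? xs ++ replicate (count 1 xs) 1
ones-↭ [] = ↭-refl
ones-↭ (x ∷ xs) with x ≡ᵇ 1 in eq
... | true rewrite ≡ᵇ-sound {x} eq =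
  ↭-trans (prep 1 (ones-↭ xs)) (↭-sym (shift 1 (filter notOne? xs) (replicate (count 1 xs) 1)))
... | false = prep x (ones-↭ xs)

count-ones-replicate : ∀ k → count 1 (replicate k 1) ≡ k
count-ones-replicate zero = refl
count-ones-replicate (suc k) = cong suc (count-ones-replicate k)

count-ones-notOne : ∀ xs → count 1 (filter notOne? xs) ≡ 0
count-ones-notOne [] = refl
count-ones-notOne (x ∷ xs) with x ≡ᵇ 1 in eq
... | true = count-ones-notOne xs
... | false rewrite eq = count-ones-notOne xs

filter-notOne-replicate : ∀ k → filter notOne? (replicate k 1) ≡ []
filter-notOne-replicate zero = refl
filter-notOne-replicate (suc k) = filter-notOne-replicate k

count-++ : ∀ i xs ys → count i (xs ++ ys) ≡ count i xs + count i ys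
count-++ i xs ys = trans (cong length (ListP.filter-++ (λ p → p ℕ.≟ i) xs ys))
  (ListP.length-++ (filter (λ p → p ℕ.≟ i) xs))

count-↭ : ∀ i {xs ys} → xs ↭ ys → count i xs ≡ count i ys
count-↭ i xs↭ys = ↭-length (filter-↭ (ℕ._≟ i) xs↭ys)

sum-replicate-one : ∀ k → sum (replicate k 1) ≡ k
sum-replicate-one zero = refl
sum-replicate-one (suc k) = cong suc (sum-replicate-one k)

sum≡sum-notOne+count-ones : ∀ xs → sum xs ≡ sum (filter notOne? xs) + count 1 xs
sum≡sum-notOne+count-ones xs = trans (sum-↭ (ones-↭ xs)) (trans (sum-++ (filter notOne? xs) _)
  (cong (sum (filter notOne? xs) +_) (sum-replicate-one (count 1 xs))))

∈-replicate-one : ∀ {k x} → x ∈ replicate k 1 → x ≡ 1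
∈-replicate-one {suc k} (here e) = e
∈-replicate-one {suc k} (there m) = ∈-replicate-one {k} m

map-const-one : ∀ {A : Set} (f : A → ℕ) xs → (∀ x → x ∈ xs → f x ≡ 1) → map f xs ≡ replicate (length xs) 1
map-const-one f [] _ = refl
map-const-one f (x ∷ xs) one = cong₂ _∷_ (one x (here refl)) (map-const-one f xs (λ y m → one y (there m)))

replicate-++ : ∀ {A : Set} m k (x : A) → replicate m x ++ replicate k x ≡ replicate (m + k) x
replicate-++ zero k x = refl
replicate-++ (suc m) k x = cong (x ∷_) (replicate-++ m k x)

-- Enumerating partial maps and subsets

∈-concatMap-cons : ∀ {A : Set} {k} (R : List (Vec A k)) ys {a v} → a ∈ ys → v ∈ R →
  (a ∷ v) ∈ concatMap (λ x → map (x ∷_) R) ys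
∈-concatMap-cons R (y ∷ ys) (here refl) v∈R = ∈-++⁺ˡ (∈-map⁺ (_ ∷_) v∈R)
∈-concatMap-cons R (y ∷ ys) (there a∈ys) v∈R = ∈-++⁺ʳ (map (y ∷_) R) (∈-concatMap-cons R ys a∈ys v∈R)

allVecs-complete : ∀ {A : Set} (xs : List A) → (∀ a → a ∈ xs) → ∀ k (v : Vec A k) → v ∈ allVecs xs k
allVecs-complete xs complete zero [] = here refl
allVecs-complete xs complete (suc k) (a ∷ v) =
  ∈-concatMap-cons (allVecs xs k) xs (complete a) (allVecs-complete xs complete k v)

head-∈-concatMap-cons : ∀ {A : Set} {k} (R : List (Vec A k)) ys {v} →
  v ∈ concatMap (λ x → map (x ∷_) R) ys → Vec.head v ∈ ys
head-∈-concatMap-cons R (y ∷ ys) m with ∈-++⁻ (map (y ∷_) R) m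
... | inj₁ m₁ = let (_ , _ , e) = ∈-map⁻ (y ∷_) m₁ in here (cong Vec.head e)
... | inj₂ m₂ = there (head-∈-concatMap-cons R ys m₂)

unique-concatMap-cons : ∀ {A : Set} {k} (R : List (Vec A k)) ys → Unique ys → Unique R →
  Unique (concatMap (λ x → map (x ∷_) R) ys)
unique-concatMap-cons R [] _ _ = []
unique-concatMap-cons R (y ∷ ys) (y∉ys ∷ uys) uR =
  Unique.++⁺ (Unique.map⁺ VecP.∷-injectiveʳ uR) (unique-concatMap-cons R ys uys uR) disjoint
  where
  disjoint : ∀ {v} → ¬ (v ∈ map (y ∷_) R × v ∈ concatMap (λ x → map (x ∷_) R) ys)
  disjoint (m₁ , m₂) = let (_ , _ , e) = ∈-map⁻ (y ∷_) m₁ in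
    All.lookup y∉ys (subst (_∈ ys) (cong Vec.head e) (head-∈-concatMap-cons R ys m₂)) refl

allVecs-unique : ∀ {A : Set} (xs : List A) → Unique xs → ∀ k → Unique (allVecs xs k)
allVecs-unique xs uxs zero = [] ∷ []
allVecs-unique xs uxs (suc k) = unique-concatMap-cons (allVecs xs k) xs uxs (allVecs-unique xs uxs k)

length-≤-injection : ∀ {A B : Set} (xs : List A) (ys : List B) (f : A → B) → Unique xs →
  (∀ {x} → x ∈ xs → f x ∈ ys) → (∀ {x x′} → x ∈ xs → x′ ∈ xs → f x ≡ f x′ → x ≡ x′) →
  length xs ≤ length ys
length-≤-injection [] ys f _ _ _ = z≤n
length-≤-injection (x ∷ xs) ys f (x∉xs ∷ uxs) into inj with ∈-∃++ (into (here refl))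
... | as , bs , refl = subst (suc (length xs) ≤_) (sym length-as-fx-bs)
  (s≤s (length-≤-injection xs (as ++ bs) f uxs into′ (λ m m′ → inj (there m) (there m′))))
  where
  length-as-fx-bs : length (as ++ f x ∷ bs) ≡ suc (length (as ++ bs))
  length-as-fx-bs = trans (ListP.length-++ as)
    (trans (ℕP.+-suc (length as) (length bs)) (cong suc (sym (ListP.length-++ as))))
  into′ : ∀ {x′} → x′ ∈ xs → f x′ ∈ as ++ bs
  into′ {x′} m with ∈-++⁻ as (into (there m))
  ... | inj₁ a = ∈-++⁺ˡ a
  ... | inj₂ (here e) = ⊥-elim (All.lookup x∉xs m (sym (inj (there m) (here refl) e)))
  ... | inj₂ (there b) = ∈-++⁺ʳ as b

countList-bijection : ∀ {A B : Set} (P : A → Bool) (Q : B → Bool) (xs : List A) (ys : List B) →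
  Unique xs → Unique ys → (f : A → B) (g : B → A) →
  (∀ x → x ∈ xs → P x ≡ true → f x ∈ ys × Q (f x) ≡ true × g (f x) ≡ x) →
  (∀ y → y ∈ ys → Q y ≡ true → g y ∈ xs × P (g y) ≡ true × f (g y) ≡ y) →
  countList P xs ≡ countList Q ys
countList-bijection P Q xs ys uxs uys f g fwd bwd = begin
  countList P xs                    ≡⟨ sym (length-filter≡countList (T? ∘ P) xs) ⟩
  length (filter (T? ∘ P) xs)
    ≡⟨ ℕP.≤-antisym (≤-by {g′ = g} f P Q xs ys uxs fwd) (≤-by {g′ = f} g Q P ys xs uys bwd) ⟩
  length (filter (T? ∘ Q) ys)        ≡⟨ length-filter≡countList (T? ∘ Q) ys ⟩
  countList Q ys ∎
  where
  open ≡-Reasoning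
  ≤-by : ∀ {A B : Set} {g′ : B → A} (f′ : A → B) (P′ : A → Bool) (Q′ : B → Bool) xs′ ys′ → Unique xs′ →
    (∀ x → x ∈ xs′ → P′ x ≡ true → f′ x ∈ ys′ × Q′ (f′ x) ≡ true × g′ (f′ x) ≡ x) →
    length (filter (T? ∘ P′) xs′) ≤ length (filter (T? ∘ Q′) ys′)
  ≤-by {g′ = g′} f′ P′ Q′ xs′ ys′ uxs′ fwd′ =
    length-≤-injection (filter (T? ∘ P′) xs′) (filter (T? ∘ Q′) ys′) f′ (Unique.filter⁺ (T? ∘ P′) uxs′)
      (λ m → let (m′ , Px) = ∈-filter⁻ (T? ∘ P′) m ; (fm , Qfx , _) = fwd′ _ m′ (T⇒≡true Px) in
             ∈-filter⁺ (T? ∘ Q′) fm (≡true⇒T Qfx))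
      (λ m₁ m₂ e → let (a₁ , P₁) = ∈-filter⁻ (T? ∘ P′) m₁ ; (a₂ , P₂) = ∈-filter⁻ (T? ∘ P′) m₂ in
         trans (sym (proj₂ (proj₂ (fwd′ _ a₁ (T⇒≡true P₁))))) (trans (cong g′ e) (proj₂ (proj₂ (fwd′ _ a₂ (T⇒≡true P₂))))))

maybeFin-unique : ∀ m → Unique (nothing ∷ map just (allFin m))
maybeFin-unique m = nothing∉ (allFin m) ∷ Unique.map⁺ MaybeP.just-injective (Unique.allFin⁺ m)
  where
  nothing∉ : ∀ {A : Set} (xs : List A) → All (nothing ≢_) (map just xs)
  nothing∉ [] = []
  nothing∉ (x ∷ xs) = (λ ()) ∷ nothing∉ xs

maybeFin-complete : ∀ {m} (x : Maybe (Fin m)) → x ∈ nothing ∷ map just (allFin m)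
maybeFin-complete nothing = here refl
maybeFin-complete (just x) = there (∈-map⁺ just (∈-allFin x))

allPMaps-unique : ∀ n → Unique (allPMaps n)
allPMaps-unique n = Unique.map⁺ (λ { refl → refl }) (allVecs-unique _ (maybeFin-unique (n * 2)) (n * 2))

allPMaps-complete : ∀ n (α : PMap n) → α ∈ allPMaps n
allPMaps-complete n (pmap t) = ∈-map⁺ pmap (allVecs-complete _ maybeFin-complete (n * 2) t)

allSubsets : (m : ℕ) → List (Subset m)
allSubsets = allVecs (true ∷ false ∷ [])

allSubsets-complete : ∀ m (E : Subset m) → E ∈ allSubsets m
allSubsets-complete = allVecs-complete _ (λ { true → here refl ; false → there (here refl) })

allSubsets-unique : ∀ m → Unique (allSubsets m)
allSubsets-unique = allVecs-unique _ (((λ ()) ∷ []) ∷ [] ∷ [])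

countList-allSubsets-suc : ∀ m (P : Subset (suc m) → Bool) →
  countList P (allSubsets (suc m)) ≡ countList (P ∘ (true ∷_)) (allSubsets m) + countList (P ∘ (false ∷_)) (allSubsets m)
countList-allSubsets-suc m P = trans (countList-++ P (map (true ∷_) (allSubsets m)) _)
  (cong₂ _+_ (countList-map P (true ∷_) (allSubsets m))
    (trans (countList-++ P (map (false ∷_) (allSubsets m)) [])
      (trans (ℕP.+-identityʳ _) (countList-map P (false ∷_) (allSubsets m)))))

∣∣≡countFin-lookup : ∀ {m} (E : Subset m) → ∣ E ∣ ≡ countFin m (lookup E)
∣∣≡countFin-lookup [] = refl
∣∣≡countFin-lookup (true ∷ E) = cong suc (∣∣≡countFin-lookup E)
∣∣≡countFin-lookup (false ∷ E) = ∣∣≡countFin-lookup E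

∣tabulate∣≡countFin : ∀ {m} (p : Fin m → Bool) → ∣ tabulate p ∣ ≡ countFin m p
∣tabulate∣≡countFin {m} p = trans (∣∣≡countFin-lookup (tabulate p)) (countFin-cong m (VecP.lookup∘tabulate p))

⊆?-sound : ∀ {m} (E A : Subset m) → does (E ⊆? A) ≡ true → ∀ y → lookup E y ≡ true → lookup A y ≡ true
⊆?-sound E A e y Ey with E ⊆? A
... | yes E⊆A = VecP.[]=⇒lookup (E⊆A (VecP.lookup⇒[]= y E Ey))

⊆?-complete : ∀ {m} (E A : Subset m) → (∀ y → lookup E y ≡ true → lookup A y ≡ true) → does (E ⊆? A) ≡ true
⊆?-complete E A E⊆A = dec-true (E ⊆? A) (λ {y} y∈E → VecP.lookup⇒[]= y A (E⊆A y (VecP.[]=⇒lookup y∈E)))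

HasSize⊆ : ∀ {m} → Subset m → ℕ → Subset m → Bool
HasSize⊆ A j E = does (E ⊆? A) ∧ (∣ E ∣ ≡ᵇ j)

countList-subsets-of-size : ∀ {m} (A : Subset m) j → countList (HasSize⊆ A j) (allSubsets m) ≡ ∣ A ∣ C j
countList-subsets-of-size [] zero = refl
countList-subsets-of-size [] (suc j) = refl
countList-subsets-of-size {suc m} (false ∷ A) j =
  trans (countList-allSubsets-suc m (HasSize⊆ (false ∷ A) j))
    (cong₂ _+_ (countList-false _ (allSubsets m) (λ _ → refl)) (countList-subsets-of-size A j))
countList-subsets-of-size {suc m} (true ∷ A) zero =
  trans (countList-allSubsets-suc m (HasSize⊆ (true ∷ A) zero))
    (cong₂ _+_ (countList-false _ (allSubsets m) (λ E → ∧-zeroʳ (does (E ⊆? A)))) (countList-subsets-of-size A zero))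
countList-subsets-of-size {suc m} (true ∷ A) (suc j) =
  trans (countList-allSubsets-suc m (HasSize⊆ (true ∷ A) (suc j)))
    (trans (cong₂ _+_ (countList-subsets-of-size A j) (countList-subsets-of-size A (suc j)))
      (nCk+nC[k+1]≡[n+1]C[k+1] ∣ A ∣ j))

ℕ/1≡mkℚ : ∀ k → (ℤ.+ k) ℚ./ 1 ≡ mkℚ (ℤ.+ k) 0 (Coprime.sym (Coprime.1-coprimeTo k))
ℕ/1≡mkℚ k = ℚP.normalize-coprime (Coprime.sym (Coprime.1-coprimeTo k))

suc/1≡1+ : ∀ k → (ℤ.+ suc k) ℚ./ 1 ≡ 1ℚ ℚ.+ (ℤ.+ k) ℚ./ 1
suc/1≡1+ k = trans (cong (ℚ._/ 1) (cong (λ z → ℤ.+ 1 ℤ.+ z) (sym (ℤP.*-identityʳ (ℤ.+ k)))))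
  (sym (cong₂ ℚ._+_ (ℕ/1≡mkℚ 1) (ℕ/1≡mkℚ k)))

ℚsum-indicator : ∀ {A : Set} (P : A → Bool) (c : ℚ) xs →
  ℚsum (map (λ x → indicator (P x) ℚ.* c) xs) ≡ ((ℤ.+ countList P xs) ℚ./ 1) ℚ.* c
ℚsum-indicator P c [] = sym (ℚP.*-zeroˡ c)
ℚsum-indicator P c (x ∷ xs) with P x
... | true = begin
  1ℚ ℚ.* c ℚ.+ ℚsum (map (λ x → indicator (P x) ℚ.* c) xs) ≡⟨ cong (1ℚ ℚ.* c ℚ.+_) (ℚsum-indicator P c xs) ⟩
  1ℚ ℚ.* c ℚ.+ ((ℤ.+ countList P xs) ℚ./ 1) ℚ.* c
    ≡⟨ sym (ℚP.*-distribʳ-+ c 1ℚ ((ℤ.+ countList P xs) ℚ./ 1)) ⟩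
  (1ℚ ℚ.+ (ℤ.+ countList P xs) ℚ./ 1) ℚ.* c
    ≡⟨ cong (ℚ._* c) (sym (suc/1≡1+ (countList P xs))) ⟩
  ((ℤ.+ suc (countList P xs)) ℚ./ 1) ℚ.* c ∎
  where open ≡-Reasoning
... | false = trans (cong₂ ℚ._+_ (ℚP.*-zeroˡ c) (ℚsum-indicator P c xs)) (ℚP.+-identityˡ _)

ℕ/1*-indicator : ∀ b k m (c : ℚ) → (b ≡ true → k ≡ m) → (b ≡ false → k ≡ 0) →
  ((ℤ.+ k) ℚ./ 1) ℚ.* c ≡ (c ℚ.* ((ℤ.+ m) ℚ./ 1)) ℚ.* indicator b
ℕ/1*-indicator true k m c k≡m _ rewrite k≡m refl =
  trans (ℚP.*-comm ((ℤ.+ m) ℚ./ 1) c) (sym (ℚP.*-identityʳ (c ℚ.* ((ℤ.+ m) ℚ./ 1))))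
ℕ/1*-indicator false k m c _ k≡0 rewrite k≡0 refl =
  trans (ℚP.*-zeroˡ c) (sym (ℚP.*-zeroʳ (c ℚ.* ((ℤ.+ m) ℚ./ 1))))

-- The partial bijections of coset-type λ that ω trivially extends

module Contributions {n : ℕ} (ω : Permutation′ (n * 2)) (λ′ : Partition) where

  open Restriction {n} ω

  m₁ : ℕ
  m₁ = mult 1 λ′

  isTrivialCycle : Pt n → Bool
  isTrivialCycle r = isLeast W r ∧ (cycleSize r ≡ᵇ 1)

  isNontrivialCycle : Pt n → Bool
  isNontrivialCycle r = isLeast W r ∧ not (cycleSize r ≡ᵇ 1)

  trivialCycles : Subset N
  trivialCycles = tabulate isTrivialCycle

  λ̄∪1s : List ℕ
  λ̄∪1s = barParts λ′ ++ replicate (n ∸ sum (barParts λ′)) 1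

  ctMatches : Bool
  ctMatches = ct W ≈ₘ λ̄∪1s

  Contributes : PMap n → Bool
  Contributes α = (isPartialBij α ∧ (ct α ≈ₘ parts λ′)) ∧ isTrivialExt α W

  -- A contributing α is the restriction of ω to the trivial cycles recorded by its code
  -- together with all the nontrivial cycles.
  encode : PMap n → Subset N
  encode α = tabulate (λ y → inDom α y ∧ isTrivialCycle y)

  selected : Subset N → Pt n → Bool
  selected E y = any (λ r → (lookup E r ∨ isNontrivialCycle r) ∧ Connected r y) (allFin N)

  decode : Subset N → PMap n
  decode E = restrict (selected E)

  lookup-encode : ∀ α y → lookup (encode α) y ≡ (inDom α y ∧ isTrivialCycle y)
  lookup-encode α = VecP.lookup∘tabulate (λ y → inDom α y ∧ isTrivialCycle y)

  lookup-trivialCycles : ∀ y → lookup trivialCycles y ≡ isTrivialCycle y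
  lookup-trivialCycles = VecP.lookup∘tabulate isTrivialCycle

  ∈-leastIn : ∀ D r → D r ≡ true → isLeast W r ≡ true → r ∈ leastIn D
  ∈-leastIn D r dr lr = ∈-filter⁺ (λ x → T? (D x ∧ isLeast W x)) (∈-allFin r) (≡true⇒T (∧-intro dr lr))

  cycles-split : ∀ D → map cycleSize (leastIn (λ _ → true)) ↭ map cycleSize (leastIn D) ++ map cycleSize (leastIn (not ∘ D))
  cycles-split D = subst (map cycleSize (leastIn (λ _ → true)) ↭_) (ListP.map-++ cycleSize (leastIn D) _)
    (↭-map⁺ cycleSize (filter-↭-split D (isLeast W) (allFin N)))

  count-ones-leastIn : ∀ D → count 1 (map cycleSize (leastIn D)) ≡ countFin N (λ y → (D y ∧ isLeast W y) ∧ (cycleSize y ≡ᵇ 1))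
  count-ones-leastIn D = begin
    count 1 (map cycleSize (leastIn D))
      ≡⟨ length-filter≡countList isOne? (map cycleSize (leastIn D)) ⟩
    countList (_≡ᵇ 1) (map cycleSize (leastIn D))
      ≡⟨ countList-map (_≡ᵇ 1) cycleSize (leastIn D) ⟩
    countList (λ y → cycleSize y ≡ᵇ 1) (leastIn D)
      ≡⟨ countList-filter _ (λ y → D y ∧ isLeast W y) (allFin N) ⟩
    countList (λ y → (D y ∧ isLeast W y) ∧ (cycleSize y ≡ᵇ 1)) (allFin N)
      ≡⟨ sym (length-filter≡countList (λ y → T? ((D y ∧ isLeast W y) ∧ (cycleSize y ≡ᵇ 1))) (allFin N)) ⟩
    length (filter (λ y → T? ((D y ∧ isLeast W y) ∧ (cycleSize y ≡ᵇ 1))) (allFin N))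
      ≡⟨ length-filter-tabulate _ N (λ i → i) ⟩
    countFin N (λ y → (D y ∧ isLeast W y) ∧ (cycleSize y ≡ᵇ 1)) ∎
    where open ≡-Reasoning

  module Contributing (α : PMap n) (contributes : Contributes α ≡ true) where

    private
      D = inDom α

    isPB : isPartialBij α ≡ true
    isPB = ∧-elimˡ (∧-elimˡ contributes)

    trivExt : isTrivialExt α W ≡ true
    trivExt = ∧-elimʳ {isPartialBij α ∧ (ct α ≈ₘ parts λ′)} contributes

    closed : Closed D
    closed = agrees⇒closed α isPB (agrees-sound α (∧-elimˡ trivExt))

    α≡restrict : α ≡ restrict D
    α≡restrict = agrees⇒restrict α (agrees-sound α (∧-elimˡ trivExt))

    ct-α : ct α ≡ map cycleSize (leastIn D)
    ct-α = trans (cong ct α≡restrict) (ct-restrict D closed)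

    ct-α↭λ : map cycleSize (leastIn D) ↭ parts λ′
    ct-α↭λ = subst (_↭ parts λ′) ct-α (≈ₘ⇒↭ (ct α) (parts λ′) (∧-elimʳ {isPartialBij α} (∧-elimˡ contributes)))

    domSize-α : domSize α ≡ size λ′ * 2
    domSize-α = begin
      domSize α                              ≡⟨ cong domSize α≡restrict ⟩
      domSize (restrict D)                   ≡⟨ domSize-restrict≡sum-ct*2 D closed ⟩
      sum (ct (restrict D)) * 2              ≡⟨ cong (λ t → sum t * 2) (ct-restrict D closed) ⟩
      sum (map cycleSize (leastIn D)) * 2    ≡⟨ cong (_* 2) (sum-↭ ct-α↭λ) ⟩
      size λ′ * 2 ∎
      where open ≡-Reasoning

    ⌊domSize/2⌋ : ⌊ domSize α /2⌋ ≡ size λ′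
    ⌊domSize/2⌋ = trans (cong ⌊_/2⌋ domSize-α) (⌊n*2/2⌋≡n (size λ′))

    cycles-W↭ : map cycleSize (leastIn (λ _ → true)) ↭ map cycleSize (leastIn D) ++ replicate (n ∸ size λ′) 1
    cycles-W↭ = subst₂ (λ u v → u ↭ map cycleSize (leastIn D) ++ replicate v 1) ct-W added-ones
      (subst (λ u → ct W ↭ u ++ replicate ⌊ domSize W ∸ domSize α /2⌋ 1) ct-α
        (≈ₘ⇒↭ (ct W) (ct α ++ replicate ⌊ domSize W ∸ domSize α /2⌋ 1) (∧-elimʳ {all (λ x → not (inDom α x) ∨ (app W x =?ₘ app α x)) (allFin N)} trivExt)))
      where
      added-ones : ⌊ domSize W ∸ domSize α /2⌋ ≡ n ∸ size λ′
      added-ones = trans (cong₂ (λ u v → ⌊ u ∸ v /2⌋) domSize-W domSize-α) (⌊[m*2∸n*2]/2⌋≡m∸n n (size λ′))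

    outside-trivial : ∀ r → r ∈ leastIn (not ∘ D) → cycleSize r ≡ 1
    outside-trivial r r∈ = ∈-replicate-one (∈-resp-↭ outside↭ones (∈-map⁺ cycleSize r∈))
      where
      outside↭ones : map cycleSize (leastIn (not ∘ D)) ↭ replicate (n ∸ size λ′) 1
      outside↭ones = ↭-++-cancelˡ (map cycleSize (leastIn D)) (↭-trans (↭-sym (cycles-split D)) cycles-W↭)

    ctMatches-true : size λ′ ≤ n → ctMatches ≡ true
    ctMatches-true |λ′|≤n = ↭⇒≈ₘ (ct W) λ̄∪1s (begin
      ct W                                                               ≡⟨ ct-W ⟩
      map cycleSize (leastIn (λ _ → true))                               ↭⟨ cycles-W↭ ⟩
      map cycleSize (leastIn D) ++ replicate (n ∸ size λ′) 1             ↭⟨ ++⁺ʳ _ ct-α↭λ ⟩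
      parts λ′ ++ replicate (n ∸ size λ′) 1                              ↭⟨ ++⁺ʳ _ (ones-↭ (parts λ′)) ⟩
      (barParts λ′ ++ replicate m₁ 1) ++ replicate (n ∸ size λ′) 1       ≡⟨ ListP.++-assoc (barParts λ′) _ _ ⟩
      barParts λ′ ++ (replicate m₁ 1 ++ replicate (n ∸ size λ′) 1)
        ≡⟨ cong (barParts λ′ ++_) (replicate-++ m₁ _ 1) ⟩
      barParts λ′ ++ replicate (m₁ + (n ∸ size λ′)) 1
        ≡⟨ cong (λ k → barParts λ′ ++ replicate k 1) ones ⟩
      barParts λ′ ++ replicate (n ∸ sum (barParts λ′)) 1 ∎)
      where
      open PermutationReasoning
      |λ|≡|λ̄|+m₁ : size λ′ ≡ sum (barParts λ′) + m₁
      |λ|≡|λ̄|+m₁ = sum≡sum-notOne+count-ones (parts λ′)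
      m₁≤n∸|λ̄| : m₁ ≤ n ∸ sum (barParts λ′)
      m₁≤n∸|λ̄| = subst (_≤ n ∸ sum (barParts λ′)) (ℕP.m+n∸m≡n (sum (barParts λ′)) m₁)
        (ℕP.∸-monoˡ-≤ (sum (barParts λ′)) (subst (_≤ n) |λ|≡|λ̄|+m₁ |λ′|≤n))
      ones : m₁ + (n ∸ size λ′) ≡ n ∸ sum (barParts λ′)
      ones = trans (cong (λ t → m₁ + (n ∸ t)) |λ|≡|λ̄|+m₁)
        (trans (cong (m₁ +_) (sym (ℕP.∸-+-assoc n (sum (barParts λ′)) m₁))) (ℕP.m+[n∸m]≡n m₁≤n∸|λ̄|))

    encode-hasSize : HasSize⊆ trivialCycles m₁ (encode α) ≡ true
    encode-hasSize = ∧-intro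
      (⊆?-complete (encode α) trivialCycles (λ y e →
        trans (lookup-trivialCycles y) (∧-elimʳ {D y} (trans (sym (lookup-encode α y)) e))))
      (≡ᵇ-complete (begin
        ∣ encode α ∣
          ≡⟨ ∣tabulate∣≡countFin (λ y → D y ∧ isTrivialCycle y) ⟩
        countFin N (λ y → D y ∧ isTrivialCycle y)
          ≡⟨ countFin-cong N (λ y → sym (∧-assoc (D y) _ _)) ⟩
        countFin N (λ y → (D y ∧ isLeast W y) ∧ (cycleSize y ≡ᵇ 1))   ≡⟨ sym (count-ones-leastIn D) ⟩
        count 1 (map cycleSize (leastIn D))                           ≡⟨ count-↭ 1 ct-α↭λ ⟩
        m₁ ∎))
      where open ≡-Reasoning

    nontrivial-in-domain : ∀ r → isNontrivialCycle r ≡ true → D r ≡ true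
    nontrivial-in-domain r nr with D r in dr
    ... | true = refl
    ... | false = ⊥-elim (not-¬
      (≡ᵇ-complete (outside-trivial r (∈-leastIn (not ∘ D) r (cong not dr) (∧-elimˡ nr))))
      (not-injective (∧-elimʳ {isLeast W r} nr)))

    selected-encode : ∀ y → selected (encode α) y ≡ D y
    selected-encode y = ≡true-ext to from
      where
      to : selected (encode α) y ≡ true → D y ≡ true
      to e = let (r , q) = anyFin-elim (λ r → (lookup (encode α) r ∨ isNontrivialCycle r) ∧ Connected r y) e
             in connected-ind (λ t → D t ≡ true) r (in-domain r (∧-elimˡ q)) closed y (∧-elimʳ {lookup (encode α) r ∨ _} q)
        where
        in-domain : ∀ r → (lookup (encode α) r ∨ isNontrivialCycle r) ≡ true → D r ≡ true
        in-domain r e with ∨-elim {lookup (encode α) r} e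
        ... | inj₁ er = ∧-elimˡ (trans (sym (lookup-encode α r)) er)
        ... | inj₂ nr = nontrivial-in-domain r nr
      from : D y ≡ true → selected (encode α) y ≡ true
      from dy =
        let (r₀ , least₀ , r₀y) = representative y
            dr₀ = connected-ind (λ t → D t ≡ true) y dy closed r₀ (connected-sym r₀ y r₀y)
        in anyFin-intro (λ r → (lookup (encode α) r ∨ isNontrivialCycle r) ∧ Connected r y) r₀
             (∧-intro (recorded r₀ dr₀ least₀) r₀y)
        where
        recorded : ∀ r → D r ≡ true → isLeast W r ≡ true → (lookup (encode α) r ∨ isNontrivialCycle r) ≡ true
        recorded r dr lr with true-or-false (cycleSize r ≡ᵇ 1)
        ... | inj₁ t = ∨-introˡ _ (trans (lookup-encode α r) (∧-intro dr (∧-intro lr t)))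
        ... | inj₂ t = ∨-introʳ (lookup (encode α) r) (∧-intro lr (cong not t))

    decode-encode : decode (encode α) ≡ α
    decode-encode = trans (restrict-cong selected-encode) (sym α≡restrict)

  module Decoding (matches : ctMatches ≡ true) (E : Subset N) (hasSize : HasSize⊆ trivialCycles m₁ E ≡ true) where

    private
      D = selected E

    E⊆trivial : ∀ y → lookup E y ≡ true → isTrivialCycle y ≡ true
    E⊆trivial y e = trans (sym (lookup-trivialCycles y)) (⊆?-sound E trivialCycles (∧-elimˡ hasSize) y e)

    recorded-least : ∀ r → (lookup E r ∨ isNontrivialCycle r) ≡ true → isLeast W r ≡ true
    recorded-least r e with ∨-elim {lookup E r} e
    ... | inj₁ er = ∧-elimˡ (E⊆trivial r er)
    ... | inj₂ nr = ∧-elimˡ nr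

    closed : Closed D
    closed z y dz zy =
      let (r , q) = anyFin-elim (λ r → (lookup E r ∨ isNontrivialCycle r) ∧ Connected r z) dz
      in anyFin-intro (λ r → (lookup E r ∨ isNontrivialCycle r) ∧ Connected r y) r
           (∧-intro (∧-elimˡ q) (connected-step r z y (∧-elimʳ {lookup E r ∨ isNontrivialCycle r} q) zy))

    selected-least : ∀ y → (D y ∧ isLeast W y) ≡ (lookup E y ∨ isNontrivialCycle y)
    selected-least y = ≡true-ext to from
      where
      to : (D y ∧ isLeast W y) ≡ true → (lookup E y ∨ isNontrivialCycle y) ≡ true
      to e = let (r , q) = anyFin-elim (λ r → (lookup E r ∨ isNontrivialCycle r) ∧ Connected r y) (∧-elimˡ e)
                 recorded = ∧-elimˡ q
                 r≡y = isLeast-unique r y (recorded-least r recorded) (∧-elimʳ {D y} e)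
                         (∧-elimʳ {lookup E r ∨ isNontrivialCycle r} q)
             in subst (λ t → (lookup E t ∨ isNontrivialCycle t) ≡ true) r≡y recorded
      from : (lookup E y ∨ isNontrivialCycle y) ≡ true → (D y ∧ isLeast W y) ≡ true
      from e = ∧-intro (anyFin-intro (λ r → (lookup E r ∨ isNontrivialCycle r) ∧ Connected r y) y
                 (∧-intro e (connected-refl y)))
               (recorded-least y e)

    selected-trivial : ∀ y → ((D y ∧ isLeast W y) ∧ (cycleSize y ≡ᵇ 1)) ≡ lookup E y
    selected-trivial y rewrite selected-least y with lookup E y in ey
    ... | true = ∧-elimʳ {isLeast W y} (E⊆trivial y ey)
    ... | false = contradictory (isLeast W y) (cycleSize y ≡ᵇ 1)
      where
      contradictory : ∀ a b → (a ∧ not b) ∧ b ≡ false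
      contradictory true true = refl
      contradictory true false = refl
      contradictory false b = refl

    outside-trivial : ∀ r → r ∈ leastIn (not ∘ D) → cycleSize r ≡ 1
    outside-trivial r r∈ =
      let q = T⇒≡true (proj₂ (∈-filter⁻ (λ x → T? (not (D x) ∧ isLeast W x)) {xs = allFin N} r∈))
          lr = ∧-elimʳ {not (D r)} q
          not-recorded = trans (sym (selected-least r)) (cong (_∧ isLeast W r) (not-injective (∧-elimˡ q)))
          not-nontrivial = trans (sym (cong (_∧ not (cycleSize r ≡ᵇ 1)) lr))
                             (∨-conicalʳ (lookup E r) (isNontrivialCycle r) not-recorded)
      in ≡ᵇ-sound (not-injective not-nontrivial)

    outside-ones : map cycleSize (leastIn (not ∘ D)) ≡ replicate (length (leastIn (not ∘ D))) 1
    outside-ones = map-const-one cycleSize _ outside-trivial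

    count-ones : count 1 (map cycleSize (leastIn D)) ≡ m₁
    count-ones = begin
      count 1 (map cycleSize (leastIn D))                              ≡⟨ count-ones-leastIn D ⟩
      countFin N (λ y → (D y ∧ isLeast W y) ∧ (cycleSize y ≡ᵇ 1))      ≡⟨ countFin-cong N selected-trivial ⟩
      countFin N (lookup E)                                            ≡⟨ sym (∣∣≡countFin-lookup E) ⟩
      ∣ E ∣
        ≡⟨ ≡ᵇ-sound (∧-elimʳ {does (E ⊆? trivialCycles)} hasSize) ⟩
      m₁ ∎
      where open ≡-Reasoning

    non-ones : filter notOne? (map cycleSize (leastIn D)) ↭ barParts λ′
    non-ones = begin
      filter notOne? (map cycleSize (leastIn D))
        ≡⟨ sym (ListP.++-identityʳ _) ⟩
      filter notOne? (map cycleSize (leastIn D)) ++ []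
        ≡⟨ cong (filter notOne? (map cycleSize (leastIn D)) ++_)
             (sym (trans (cong (filter notOne?) outside-ones) (filter-notOne-replicate (length (leastIn (not ∘ D)))))) ⟩
      filter notOne? (map cycleSize (leastIn D)) ++ filter notOne? (map cycleSize (leastIn (not ∘ D)))
        ≡⟨ sym (ListP.filter-++ notOne? (map cycleSize (leastIn D)) _) ⟩
      filter notOne? (map cycleSize (leastIn D) ++ map cycleSize (leastIn (not ∘ D)))
        ↭⟨ filter-↭ notOne? (↭-sym (cycles-split D)) ⟩
      filter notOne? (map cycleSize (leastIn (λ _ → true)))
        ↭⟨ filter-↭ notOne? (subst (_↭ λ̄∪1s) ct-W (≈ₘ⇒↭ (ct W) λ̄∪1s matches)) ⟩
      filter notOne? (barParts λ′ ++ replicate (n ∸ sum (barParts λ′)) 1)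
        ≡⟨ ListP.filter-++ notOne? (barParts λ′) _ ⟩
      filter notOne? (barParts λ′) ++ filter notOne? (replicate (n ∸ sum (barParts λ′)) 1)
        ≡⟨ cong₂ _++_ (ListP.filter-idem notOne? (parts λ′)) (filter-notOne-replicate (n ∸ sum (barParts λ′))) ⟩
      barParts λ′ ++ []
        ≡⟨ ListP.++-identityʳ _ ⟩
      barParts λ′ ∎
      where open PermutationReasoning

    cycles↭λ : map cycleSize (leastIn D) ↭ parts λ′
    cycles↭λ = begin
      map cycleSize (leastIn D)
        ↭⟨ ones-↭ _ ⟩
      filter notOne? (map cycleSize (leastIn D)) ++ replicate (count 1 (map cycleSize (leastIn D))) 1
        ≡⟨ cong (λ k → filter notOne? (map cycleSize (leastIn D)) ++ replicate k 1) count-ones ⟩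
      filter notOne? (map cycleSize (leastIn D)) ++ replicate m₁ 1
        ↭⟨ ++⁺ʳ _ non-ones ⟩
      barParts λ′ ++ replicate m₁ 1
        ↭⟨ ↭-sym (ones-↭ (parts λ′)) ⟩
      parts λ′ ∎
      where open PermutationReasoning

    added-ones : ⌊ domSize W ∸ domSize (decode E) /2⌋ ≡ length (leastIn (not ∘ D))
    added-ones = begin
      ⌊ domSize W ∸ domSize (decode E) /2⌋
        ≡⟨ cong₂ (λ u v → ⌊ u ∸ v /2⌋) (trans domSize-W (cong (_* 2) n≡s+u)) domSize-decode ⟩
      ⌊ (s + u) * 2 ∸ s * 2 /2⌋                   ≡⟨ ⌊[m*2∸n*2]/2⌋≡m∸n (s + u) s ⟩
      s + u ∸ s                                   ≡⟨ ℕP.m+n∸m≡n s u ⟩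
      u ∎
      where
      open ≡-Reasoning
      s = sum (map cycleSize (leastIn D))
      u = length (leastIn (not ∘ D))
      n≡s+u : n ≡ s + u
      n≡s+u = begin
        n                                                                          ≡⟨ sym sum-ct-W ⟩
        sum (ct W)                                                                 ≡⟨ cong sum ct-W ⟩
        sum (map cycleSize (leastIn (λ _ → true)))                                 ≡⟨ sum-↭ (cycles-split D) ⟩
        sum (map cycleSize (leastIn D) ++ map cycleSize (leastIn (not ∘ D)))
          ≡⟨ sum-++ (map cycleSize (leastIn D)) _ ⟩
        s + sum (map cycleSize (leastIn (not ∘ D)))
          ≡⟨ cong (λ t → s + sum t) outside-ones ⟩
        s + sum (replicate u 1)
          ≡⟨ cong (s +_) (sum-replicate-one u) ⟩
        s + u ∎
      domSize-decode : domSize (decode E) ≡ s * 2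
      domSize-decode = trans (domSize-restrict≡sum-ct*2 D closed) (cong (λ t → sum t * 2) (ct-restrict D closed))

    decode-contributes : Contributes (decode E) ≡ true
    decode-contributes = ∧-intro
      (∧-intro (restrict-isPartialBij D closed) (↭⇒≈ₘ (ct (decode E)) (parts λ′) (subst (_↭ parts λ′) (sym (ct-restrict D closed)) cycles↭λ)))
      (∧-intro (restrict-agrees D) (↭⇒≈ₘ (ct W) (ct (decode E) ++ replicate ⌊ domSize W ∸ domSize (decode E) /2⌋ 1) (begin
        ct W                                                                   ≡⟨ ct-W ⟩
        map cycleSize (leastIn (λ _ → true))                                   ↭⟨ cycles-split D ⟩
        map cycleSize (leastIn D) ++ map cycleSize (leastIn (not ∘ D))
          ≡⟨ cong (map cycleSize (leastIn D) ++_) outside-ones ⟩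
        map cycleSize (leastIn D) ++ replicate (length (leastIn (not ∘ D))) 1
          ≡⟨ cong₂ (λ u k → u ++ replicate k 1) (sym (ct-restrict D closed)) (sym added-ones) ⟩
        ct (decode E) ++ replicate ⌊ domSize W ∸ domSize (decode E) /2⌋ 1 ∎)))
      where open PermutationReasoning

    encode-decode : encode (decode E) ≡ E
    encode-decode = trans
      (VecP.tabulate-cong (λ y → trans (cong (_∧ isTrivialCycle y) (inDom-restrict D y))
        (trans (sym (∧-assoc (D y) _ _)) (selected-trivial y))))
      (VecP.tabulate∘lookup E)

  partialBijections : List (PMap n)
  partialBijections = filter (λ α → T? (isPartialBij α)) (allPMaps n)

  ∣trivialCycles∣ : ctMatches ≡ true → ∣ trivialCycles ∣ ≡ n ∸ sum (barParts λ′)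
  ∣trivialCycles∣ matches = begin
    ∣ trivialCycles ∣                                     ≡⟨ ∣tabulate∣≡countFin isTrivialCycle ⟩
    countFin N isTrivialCycle                             ≡⟨ sym (count-ones-leastIn (λ _ → true)) ⟩
    count 1 (map cycleSize (leastIn (λ _ → true)))        ≡⟨ cong (count 1) (sym ct-W) ⟩
    count 1 (ct W)                                        ≡⟨ count-↭ 1 (≈ₘ⇒↭ (ct W) λ̄∪1s matches) ⟩
    count 1 (barParts λ′ ++ replicate (n ∸ sum (barParts λ′)) 1)
      ≡⟨ count-++ 1 (barParts λ′) _ ⟩
    count 1 (barParts λ′) + count 1 (replicate (n ∸ sum (barParts λ′)) 1)
      ≡⟨ cong₂ _+_ (count-ones-notOne (parts λ′)) (count-ones-replicate (n ∸ sum (barParts λ′))) ⟩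
    n ∸ sum (barParts λ′) ∎
    where open ≡-Reasoning

  countList-contributes : ctMatches ≡ true → countList Contributes partialBijections ≡ (n ∸ sum (barParts λ′)) C m₁
  countList-contributes matches = begin
    countList Contributes partialBijections
      ≡⟨ countList-bijection Contributes (HasSize⊆ trivialCycles m₁) partialBijections (allSubsets N)
           (Unique.filter⁺ (λ α → T? (isPartialBij α)) (allPMaps-unique n)) (allSubsets-unique N) encode decode
           (λ α _ c → allSubsets-complete N (encode α) , Contributing.encode-hasSize α c , Contributing.decode-encode α c)
           (λ E _ h → ∈-filter⁺ (λ α → T? (isPartialBij α)) (allPMaps-complete n (decode E))
                         (≡true⇒T (∧-elimˡ (∧-elimˡ (Decoding.decode-contributes matches E h)))) ,
                      Decoding.decode-contributes matches E h , Decoding.encode-decode matches E h) ⟩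
    countList (HasSize⊆ trivialCycles m₁) (allSubsets N)
      ≡⟨ countList-subsets-of-size trivialCycles m₁ ⟩
    ∣ trivialCycles ∣ C m₁
      ≡⟨ cong (_C m₁) (∣trivialCycles∣ matches) ⟩
    (n ∸ sum (barParts λ′)) C m₁ ∎
    where open ≡-Reasoning

  countList-contributes-¬matches : size λ′ ≤ n → ctMatches ≡ false → countList Contributes partialBijections ≡ 0
  countList-contributes-¬matches |λ′|≤n ¬matches = countList-false Contributes partialBijections
    (λ α → ¬-not (λ c → not-¬ (Contributing.ctMatches-true α c |λ′|≤n) ¬matches))

  scale : ℚ
  scale = inv (2 ^ (n ∸ size λ′) * (n ∸ size λ′) !)

  ψweight : PMap n → ℚ
  ψweight α = inv (2 ^ (n ∸ ⌊ domSize α /2⌋) * (n ∸ ⌊ domSize α /2⌋) !)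

  coefficient : ∀ α → S λ′ n α ℚ.* ψbasis n α ω ≡ indicator (Contributes α) ℚ.* scale
  coefficient α with isPartialBij α ∧ (ct α ≈ₘ parts λ′) in e₁ | isTrivialExt α W in e₂
  ... | false | t = trans (ℚP.*-zeroˡ (ψweight α ℚ.* indicator t)) (sym (ℚP.*-zeroˡ scale))
  ... | true | false = trans (ℚP.*-identityˡ (ψweight α ℚ.* 0ℚ)) (trans (ℚP.*-zeroʳ (ψweight α)) (sym (ℚP.*-zeroˡ scale)))
  ... | true | true = cong (1ℚ ℚ.*_) (trans (ℚP.*-identityʳ (ψweight α))
    (cong (λ h → inv (2 ^ (n ∸ h) * (n ∸ h) !)) (Contributing.⌊domSize/2⌋ α (∧-intro e₁ e₂))))

lemma3p5 : (n : ℕ) → 1 ≤ n → (λ′ : Partition) → size λ′ ≤ n →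
    (ω : Permutation′ (n * 2)) →
    ψ n (S λ′ n) ω
      ≡ (inv (2 ^ (n ∸ size λ′) * (n ∸ size λ′) !)
          ℚ.* ((ℤ.+ ((n ∸ sum (barParts λ′)) C mult 1 λ′)) ℚ./ 1))
        ℚ.* K (barParts λ′) n ω
lemma3p5 n _ λ′ |λ′|≤n ω = begin
  ψ n (S λ′ n) ω
    ≡⟨ cong ℚsum (ListP.map-cong coefficient partialBijections) ⟩
  ℚsum (map (λ α → indicator (Contributes α) ℚ.* scale) partialBijections)
    ≡⟨ ℚsum-indicator Contributes scale partialBijections ⟩
  ((ℤ.+ countList Contributes partialBijections) ℚ./ 1) ℚ.* scale
    ≡⟨ ℕ/1*-indicator ctMatches _ _ scale countList-contributes (countList-contributes-¬matches |λ′|≤n) ⟩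
  (scale ℚ.* ((ℤ.+ ((n ∸ sum (barParts λ′)) C mult 1 λ′)) ℚ./ 1)) ℚ.* K (barParts λ′) n ω ∎
  where
  open ≡-Reasoning
  open Contributions {n} ω λ′
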